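{- Let $W$ be an $n\times n$ weighing matrix of weight $r$ such that any two distinct rows of $W$ intersect in either $0$ or $2$ places, and put $k=n-\binom{r}{2}-1$. Then $W$ is equivalent to a weighing matrix whose first $r$ rows form the $r\times\big(\binom{r}{2}+1+k\big)$ matrix $T_{r,k}$ defined as follows. The columns are split into consecutive groups. The first group consists of columns $1,\dots,r$: the entry in row $1$ and column $c$ is $1$ for all $c=1,\dots,r$; for $a=2,\dots,r$ the entry in row $a$ and column $1$ is $1$, the entry in row $a$ and column $a$ is $-1$, and all other entries of rows $2,\dots,r$ in these columns are $0$. Then, for $i=1,2,\dots,r-2$ in turn, there is a group of $r-i-1$ consecutive columns; in the $j$-th column of this group ($1\le j\le r-i-1$) the entry in row $i+1$ is $1$, the entry in row $i+1+j$ is $-1$, and all other entries are $0$. Finally there are $k$ columns all of whose entries are $0$.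
   Context: A weighing matrix of order $n$ and weight $r$ is an $n\times n$ matrix $M$ with entries in $\{0,\pm1\}$ satisfying $M^\top M=rI$. Two rows of a weighing matrix intersect in $k$ places if the sets of positions of their nonzero entries have exactly $k$ positions in common. Weighing matrices $M,N$ are equivalent if $M=PNQ$ for some signed permutation matrices $P,Q$ (a signed permutation matrix is a $\{0,\pm1\}$-matrix with exactly one nonzero entry in each row and column). -}

module Defs where

open import Data.Nat as ℕ using (ℕ; zero; suc; _<_; _<ᵇ_; _≡ᵇ_; _∸_)
open import Data.Integer as ℤ using (ℤ; +_; -_; _+_; _*_; 0ℤ; 1ℤ; -1ℤ)
open import Data.Fin using (Fin; zero; suc; toℕ; _≟_)
open import Data.Bool using (Bool; true; false; if_then_else_)
open import Data.Product using (Σ; _×_; ∃)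
open import Data.Sum using (_⊎_)
open import Relation.Nullary using (¬_; does)
open import Relation.Binary.PropositionalEquality using (_≡_; _≢_)

Matrix : ℕ → Set
Matrix n = Fin n → Fin n → ℤ

sumFin : ∀ n → (Fin n → ℤ) → ℤ
sumFin zero    f = 0ℤ
sumFin (suc n) f = f zero + sumFin n (λ l → f (suc l))

countFin : ∀ n → (Fin n → Bool) → ℕ
countFin zero    p = 0
countFin (suc n) p = (if p zero then 1 else 0) ℕ.+ countFin n (λ l → p (suc l))

_⊗_ : ∀ {n} → Matrix n → Matrix n → Matrix n
_⊗_ {n} A B i j = sumFin n (λ l → A i l * B l j)

transpose : ∀ {n} → Matrix n → Matrix n
transpose A i j = A j i

scalarId : ∀ {n} → ℤ → Matrix n
scalarId r i j = if does (i ≟ j) then r else 0ℤ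

Entry01 : ℤ → Set
Entry01 x = (x ≡ 0ℤ) ⊎ (x ≡ 1ℤ) ⊎ (x ≡ -1ℤ)

IsWeighing : ∀ n → ℕ → Matrix n → Set
IsWeighing n r M = (∀ i j → Entry01 (M i j)) × (∀ i j → (transpose M ⊗ M) i j ≡ scalarId (+ r) i j)

nonzero? : ℤ → Bool
nonzero? (+ zero) = false
nonzero? _        = true

intersection : ∀ {n} → Matrix n → Fin n → Fin n → ℕ
intersection {n} M i j = countFin n (λ c → Data.Bool._∧_ (nonzero? (M i c)) (nonzero? (M j c)))
  where import Data.Bool

IsSignedPerm : ∀ n → Matrix n → Set
IsSignedPerm n P =
  (∀ i j → Entry01 (P i j)) ×
  (∀ i → Σ (Fin n) λ j → (P i j ≢ 0ℤ) × (∀ j′ → P i j′ ≢ 0ℤ → j′ ≡ j)) ×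
  (∀ j → Σ (Fin n) λ i → (P i j ≢ 0ℤ) × (∀ i′ → P i′ j ≢ 0ℤ → i′ ≡ i))

Equivalent : ∀ n → Matrix n → Matrix n → Set
Equivalent n M N = Σ (Matrix n) λ P → Σ (Matrix n) λ Q →
  IsSignedPerm n P × IsSignedPerm n Q × (∀ i j → M i j ≡ (P ⊗ (N ⊗ Q)) i j)

-- The matrix T_{r,k}, with 0-based row index a and column index c (as natural numbers).
-- Groups i = 1, …, r-2 (m = number of groups still to come); d = column offset within
-- the remaining columns.  In the j-th column (j = d+1) of group i, row i+1 (0-based i)
-- has 1 and row i+1+j (0-based i+d+1) has -1.
Tgroups : (r i m d a : ℕ) → ℤ
Tgroups r i zero    d a = 0ℤ   -- the final k zero columns
Tgroups r i (suc m) d a =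
  if d <ᵇ (r ∸ i ∸ 1)
  then (if a ≡ᵇ i then 1ℤ else if a ≡ᵇ (i ℕ.+ d ℕ.+ 1) then -1ℤ else 0ℤ)
  else Tgroups r (suc i) m (d ∸ (r ∸ i ∸ 1)) a

T : (r k : ℕ) → (a c : ℕ) → ℤ
T r k a c =
  if c <ᵇ r
  then (if a ≡ᵇ 0 then 1ℤ else if c ≡ᵇ 0 then 1ℤ else if c ≡ᵇ a then -1ℤ else 0ℤ)
  else Tgroups r 1 (r ∸ 2) (c ∸ r) a

-- Column γ of W has r non-zero entries, and WᵀW = rI forces WWᵀ = rI. Two of the r rows
-- through γ meet in γ, hence in exactly one further column, and orthogonality of their ±1 entries makes
-- the products (entry at γ)·(entry there) opposite for the two rows; three pairwise opposite signs are
-- impossible, so no column other than γ meets three of these rows. The r C 2 further meeting columns are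
-- therefore distinct, and with γ they carry all r non-zero entries of each of the r rows. Moving these
-- rows to the top, these columns into the order of T, and rescaling rows by their entry at γ and columns
-- by the entry of their first row, turns the first r rows into T.
module Submission where

open import Defs
open import Data.Nat as ℕ using (ℕ; zero; suc; z≤n; s≤s; _≤_; _<_; _<ᵇ_; _≡ᵇ_; _∸_)
import Data.Nat.Properties as ℕP
open import Data.Nat.Combinatorics using (_C_; nC1≡n; nCk+nC[k+1]≡[n+1]C[k+1])
open import Data.Integer as ℤ using (ℤ; +_; -_; _+_; _*_; _-_; 0ℤ; 1ℤ; -1ℤ)
import Data.Integer.Properties as ℤP
open import Data.Integer.Solver using (module +-*-Solver)
open import Data.Fin as Fin using (Fin; zero; suc; toℕ; fromℕ<; _≟_)
open import Data.Fin.Properties using (suc-injective; toℕ-injective; toℕ-fromℕ<; toℕ<n; injective⇒≤; punchInᵢ≢i; any?)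
open import Data.Fin.Permutation as Perm using (Permutation′; _⟨$⟩ʳ_; _⟨$⟩ˡ_; _∘ₚ_)
open import Data.Vec.Functional using (removeAt)
open import Data.Bool using (Bool; true; false; if_then_else_; _∧_)
open import Data.Bool.Properties using (T-≡)
open import Data.Product using (Σ; _×_; _,_; proj₁; proj₂)
open import Data.Sum using (_⊎_; inj₁; inj₂; [_,_]′)
open import Data.Empty using (⊥; ⊥-elim)
open import Function using (id)
open import Function.Bundles using (Equivalence)
open import Relation.Nullary using (¬_; Dec; does; yes; no)
open import Relation.Nullary.Decidable using (dec-true; dec-false)
open import Relation.Binary.Definitions using (tri<; tri≈; tri>)
open import Relation.Binary.PropositionalEquality
import Algebra.Properties.Semiring.Sum ℤP.+-*-semiring as Σℤ
open import Algebra.Properties.AbelianGroup ℤP.+-0-abelianGroup using (∙-cancelʳ; inverseˡ-unique)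
open +-*-Solver

sumFin≡sum : ∀ n (f : Fin n → ℤ) → sumFin n f ≡ Σℤ.sum f
sumFin≡sum zero    f = refl
sumFin≡sum (suc n) f = cong (λ s → f zero + s) (sumFin≡sum n (λ l → f (suc l)))

sumFin-cong : ∀ n {f g : Fin n → ℤ} → (∀ l → f l ≡ g l) → sumFin n f ≡ sumFin n g
sumFin-cong n {f} {g} f≗g = begin
  sumFin n f  ≡⟨ sumFin≡sum n f ⟩
  Σℤ.sum f    ≡⟨ Σℤ.sum-cong-≗ f≗g ⟩
  Σℤ.sum g    ≡⟨ sumFin≡sum n g ⟨
  sumFin n g  ∎
  where open ≡-Reasoning

sumFin-distrib-+ : ∀ n (f g : Fin n → ℤ) → sumFin n (λ l → f l + g l) ≡ sumFin n f + sumFin n g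
sumFin-distrib-+ n f g = begin
  sumFin n (λ l → f l + g l)  ≡⟨ sumFin≡sum n _ ⟩
  Σℤ.sum (λ l → f l + g l)    ≡⟨ Σℤ.∑-distrib-+ f g ⟩
  Σℤ.sum f + Σℤ.sum g         ≡⟨ cong₂ _+_ (sumFin≡sum n f) (sumFin≡sum n g) ⟨
  sumFin n f + sumFin n g     ∎
  where open ≡-Reasoning

*-distribˡ-sumFin : ∀ n (c : ℤ) (f : Fin n → ℤ) → c * sumFin n f ≡ sumFin n (λ l → c * f l)
*-distribˡ-sumFin n c f = begin
  c * sumFin n f            ≡⟨ cong (c *_) (sumFin≡sum n f) ⟩
  c * Σℤ.sum f              ≡⟨ Σℤ.*-distribˡ-sum c f ⟩
  Σℤ.sum (λ l → c * f l)    ≡⟨ sumFin≡sum n _ ⟨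
  sumFin n (λ l → c * f l)  ∎
  where open ≡-Reasoning

*-distribʳ-sumFin : ∀ n (c : ℤ) (f : Fin n → ℤ) → sumFin n f * c ≡ sumFin n (λ l → f l * c)
*-distribʳ-sumFin n c f = begin
  sumFin n f * c            ≡⟨ cong (_* c) (sumFin≡sum n f) ⟩
  Σℤ.sum f * c              ≡⟨ Σℤ.*-distribʳ-sum c f ⟩
  Σℤ.sum (λ l → f l * c)    ≡⟨ sumFin≡sum n _ ⟨
  sumFin n (λ l → f l * c)  ∎
  where open ≡-Reasoning

sumFin-permute : ∀ n (f : Fin n → ℤ) (π : Permutation′ n) → sumFin n (λ l → f (π ⟨$⟩ʳ l)) ≡ sumFin n f
sumFin-permute n f π = begin
  sumFin n (λ l → f (π ⟨$⟩ʳ l))  ≡⟨ sumFin≡sum n _ ⟩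
  Σℤ.sum (λ l → f (π ⟨$⟩ʳ l))    ≡⟨ Σℤ.∑-permute f π ⟨
  Σℤ.sum f                        ≡⟨ sumFin≡sum n f ⟨
  sumFin n f                      ∎
  where open ≡-Reasoning

sumFin-comm : ∀ n m (f : Fin n → Fin m → ℤ) →
  sumFin n (λ i → sumFin m (f i)) ≡ sumFin m (λ j → sumFin n (λ i → f i j))
sumFin-comm n m f = begin
  sumFin n (λ i → sumFin m (f i))           ≡⟨ sumFin-cong n (λ i → sumFin≡sum m (f i)) ⟩
  sumFin n (λ i → Σℤ.sum (f i))             ≡⟨ sumFin≡sum n _ ⟩
  Σℤ.sum (λ i → Σℤ.sum (f i))               ≡⟨ Σℤ.∑-comm f ⟩
  Σℤ.sum (λ j → Σℤ.sum (λ i → f i j))       ≡⟨ sumFin≡sum m _ ⟨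
  sumFin m (λ j → Σℤ.sum (λ i → f i j))     ≡⟨ sumFin-cong m (λ j → sumFin≡sum n (λ i → f i j)) ⟨
  sumFin m (λ j → sumFin n (λ i → f i j))   ∎
  where open ≡-Reasoning

sumFin-single : ∀ n (f : Fin n → ℤ) (i : Fin n) → (∀ l → l ≢ i → f l ≡ 0ℤ) → sumFin n f ≡ f i
sumFin-single (suc n) f i f≗0 = begin
  sumFin (suc n) f             ≡⟨ sumFin≡sum (suc n) f ⟩
  Σℤ.sum f                     ≡⟨ Σℤ.sum-remove {i = i} f ⟩
  f i + Σℤ.sum (removeAt f i)  ≡⟨ cong (λ s → f i + s) (Σℤ.sum-cong-≗ {n} (λ k → f≗0 _ (punchInᵢ≢i i k))) ⟩
  f i + Σℤ.sum {n} (λ _ → 0ℤ) ≡⟨ cong (λ s → f i + s) (Σℤ.sum-replicate-zero n) ⟩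
  f i + 0ℤ                     ≡⟨ ℤP.+-identityʳ (f i) ⟩
  f i                          ∎
  where open ≡-Reasoning

sumFin-pair : ∀ n (f : Fin n → ℤ) {i j : Fin n} → i ≢ j →
  (∀ l → l ≢ i → l ≢ j → f l ≡ 0ℤ) → sumFin n f ≡ f i + f j
sumFin-pair n f {i} {j} i≢j f≗0 = begin
  sumFin n f                         ≡⟨ sumFin-cong n split ⟩
  sumFin n (λ l → at l + off l)      ≡⟨ sumFin-distrib-+ n at off ⟩
  sumFin n at + sumFin n off         ≡⟨ cong₂ _+_ (sumFin-single n at i at≗0) (sumFin-single n off j off≗0) ⟩
  at i + off j                       ≡⟨ cong₂ _+_ at-i off-j ⟩
  f i + f j                          ∎
  where
  open ≡-Reasoning
  at off : Fin n → ℤ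
  at  l = if does (l ≟ i) then f l else 0ℤ
  off l = if does (l ≟ i) then 0ℤ else f l
  split : ∀ l → f l ≡ at l + off l
  split l with l ≟ i
  ... | yes _ = sym (ℤP.+-identityʳ (f l))
  ... | no  _ = sym (ℤP.+-identityˡ (f l))
  at≗0 : ∀ l → l ≢ i → at l ≡ 0ℤ
  at≗0 l l≢i with l ≟ i
  ... | yes l≡i = ⊥-elim (l≢i l≡i)
  ... | no  _   = refl
  off≗0 : ∀ l → l ≢ j → off l ≡ 0ℤ
  off≗0 l l≢j with l ≟ i
  ... | yes _   = refl
  ... | no  l≢i = f≗0 l l≢i l≢j
  at-i : at i ≡ f i
  at-i with i ≟ i
  ... | yes _   = refl
  ... | no  i≢i = ⊥-elim (i≢i refl)
  off-j : off j ≡ f j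
  off-j with j ≟ i
  ... | yes j≡i = ⊥-elim (i≢j (sym j≡i))
  ... | no  _   = refl

sumFin-nonneg : ∀ n (f : Fin n → ℤ) → (∀ l → 0ℤ ℤ.≤ f l) → 0ℤ ℤ.≤ sumFin n f
sumFin-nonneg zero    f f≥0 = ℤP.≤-refl
sumFin-nonneg (suc n) f f≥0 = ℤP.+-mono-≤ (f≥0 zero) (sumFin-nonneg n (λ l → f (suc l)) (λ l → f≥0 (suc l)))

sumFin-nonneg≡0 : ∀ n (f : Fin n → ℤ) → (∀ l → 0ℤ ℤ.≤ f l) → sumFin n f ≡ 0ℤ → ∀ l → f l ≡ 0ℤ
sumFin-nonneg≡0 (suc n) f f≥0 Σf≡0 = λ where
    zero    → f0≡0
    (suc l) → sumFin-nonneg≡0 n (λ l → f (suc l)) (λ l → f≥0 (suc l)) rest≡0 l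
  where
  rest = sumFin n (λ l → f (suc l))
  rest≥0 : 0ℤ ℤ.≤ rest
  rest≥0 = sumFin-nonneg n (λ l → f (suc l)) (λ l → f≥0 (suc l))
  f0≤0 : f zero ℤ.≤ 0ℤ
  f0≤0 = subst₂ ℤ._≤_ (ℤP.+-identityʳ (f zero)) Σf≡0 (ℤP.+-monoʳ-≤ (f zero) rest≥0)
  f0≡0 : f zero ≡ 0ℤ
  f0≡0 = ℤP.≤-antisym f0≤0 (f≥0 zero)
  rest≡0 : rest ≡ 0ℤ
  rest≡0 = trans (sym (ℤP.+-identityˡ rest)) (trans (cong (_+ rest) (sym f0≡0)) Σf≡0)

square-nonneg : ∀ x → 0ℤ ℤ.≤ x * x
square-nonneg x = subst (0ℤ ℤ.≤_) (sym (square≡abs² x)) (ℤ.+≤+ z≤n)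
  where
  square≡abs² : ∀ x → x * x ≡ + (ℤ.∣ x ∣ ℕ.* ℤ.∣ x ∣)
  square≡abs² (+ n)      = ℤP.+◃n≡+n (n ℕ.* n)
  square≡abs² ℤ.-[1+ n ] = ℤP.+◃n≡+n (suc n ℕ.* suc n)

square≡0 : ∀ x → x * x ≡ 0ℤ → x ≡ 0ℤ
square≡0 x x²≡0 = [ id , id ]′ (ℤP.i*j≡0⇒i≡0∨j≡0 x x²≡0)

sumFin-*-sumFin : ∀ n m (f : Fin n → ℤ) (g : Fin m → ℤ) →
  sumFin n f * sumFin m g ≡ sumFin n (λ k → sumFin m (λ l → f k * g l))
sumFin-*-sumFin n m f g =
  trans (*-distribʳ-sumFin n _ f) (sumFin-cong n (λ k → *-distribˡ-sumFin m (f k) g))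

-- Gram matrices

sumFin² : ∀ n → (Fin n → Fin n → ℤ) → ℤ
sumFin² n F = sumFin n (λ i → sumFin n (F i))

sumFin²-distrib-+ : ∀ n (F G : Fin n → Fin n → ℤ) → sumFin² n (λ i j → F i j + G i j) ≡ sumFin² n F + sumFin² n G
sumFin²-distrib-+ n F G = trans (sumFin-cong n (λ i → sumFin-distrib-+ n (F i) (G i))) (sumFin-distrib-+ n _ _)

frobenius-MMᵀ≡MᵀM : ∀ {n} (M : Matrix n) →
  sumFin² n (λ i j → (M ⊗ transpose M) i j * (M ⊗ transpose M) i j) ≡
  sumFin² n (λ k l → (transpose M ⊗ M) k l * (transpose M ⊗ M) k l)
frobenius-MMᵀ≡MᵀM {n} M = begin
  sumFin² n (λ i j → (M ⊗ transpose M) i j * (M ⊗ transpose M) i j)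
    ≡⟨ sumFin-cong n (λ i → sumFin-cong n (λ j → sumFin-*-sumFin n n _ _)) ⟩
  sumFin n (λ i → sumFin n (λ j → sumFin n (λ k → sumFin n (λ l → F i j k l))))
    ≡⟨ sumFin-cong n (λ i → sumFin-comm n n _) ⟩
  sumFin n (λ i → sumFin n (λ k → sumFin n (λ j → sumFin n (λ l → F i j k l))))
    ≡⟨ sumFin-cong n (λ i → sumFin-cong n (λ k → sumFin-comm n n _)) ⟩
  sumFin n (λ i → sumFin n (λ k → sumFin n (λ l → sumFin n (λ j → F i j k l))))
    ≡⟨ sumFin-comm n n _ ⟩
  sumFin n (λ k → sumFin n (λ i → sumFin n (λ l → sumFin n (λ j → F i j k l))))
    ≡⟨ sumFin-cong n (λ k → sumFin-comm n n _) ⟩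
  sumFin n (λ k → sumFin n (λ l → sumFin n (λ i → sumFin n (λ j → F i j k l))))
    ≡⟨ sumFin-cong n (λ k → sumFin-cong n (λ l → sumFin-cong n (λ i → sumFin-cong n (λ j → F-swap i j k l)))) ⟩
  sumFin n (λ k → sumFin n (λ l → sumFin n (λ i → sumFin n (λ j → (M i k * M i l) * (M j k * M j l)))))
    ≡⟨ sumFin-cong n (λ k → sumFin-cong n (λ l → sym (sumFin-*-sumFin n n _ _))) ⟩
  sumFin² n (λ k l → (transpose M ⊗ M) k l * (transpose M ⊗ M) k l) ∎
  where
  open ≡-Reasoning
  F : Fin n → Fin n → Fin n → Fin n → ℤ
  F i j k l = (M i k * M j k) * (M i l * M j l)
  F-swap : ∀ i j k l → F i j k l ≡ (M i k * M i l) * (M j k * M j l)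
  F-swap i j k l = solve 4 (λ a b c d → (a :* b) :* (c :* d) := (a :* c) :* (b :* d)) refl
    (M i k) (M j k) (M i l) (M j l)

trace-MMᵀ≡MᵀM : ∀ {n} (M : Matrix n) →
  sumFin n (λ i → (M ⊗ transpose M) i i) ≡ sumFin n (λ k → (transpose M ⊗ M) k k)
trace-MMᵀ≡MᵀM {n} M = sumFin-comm n n (λ i k → M i k * M i k)

scalarId-diag : ∀ {n} (c : ℤ) (i : Fin n) → scalarId c i i ≡ c
scalarId-diag c i with i ≟ i
... | yes _   = refl
... | no  i≢i = ⊥-elim (i≢i refl)

scalarId-off : ∀ {n} (c : ℤ) {i j : Fin n} → i ≢ j → scalarId c i j ≡ 0ℤ
scalarId-off c {i} {j} i≢j with i ≟ j
... | yes i≡j = ⊥-elim (i≢j i≡j)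
... | no  _   = refl

sumFin-scalarId : ∀ n (c : ℤ) (i : Fin n) (f : Fin n → ℤ) →
  sumFin n (λ j → scalarId c i j * f j) ≡ c * f i
sumFin-scalarId n c i f =
  trans (sumFin-single n _ i (λ j j≢i → cong (_* f j) (scalarId-off c (λ i≡j → j≢i (sym i≡j)))))
        (cong (_* f i) (scalarId-diag c i))

-- The entries of MMᵀ − cI have vanishing sum of squares.
MᵀM≡cI⇒MMᵀ≡cI : ∀ {n} (M : Matrix n) (c : ℤ) →
  (∀ i j → (transpose M ⊗ M) i j ≡ scalarId c i j) →
  ∀ i j → (M ⊗ transpose M) i j ≡ scalarId c i j
MᵀM≡cI⇒MMᵀ≡cI {n} M c MᵀM≡cI i j =
  ℤP.i-j≡0⇒i≡j (A i j) (δ i j) (square≡0 (D i j) (D²≡0 i j))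
  where
  open ≡-Reasoning
  A δ D : Matrix n
  A = M ⊗ transpose M
  δ = scalarId c
  D i j = A i j - δ i j

  Y : ℤ
  Y = sumFin² n (λ k l → δ k l * δ k l)

  ΣA² : sumFin² n (λ i j → A i j * A i j) ≡ Y
  ΣA² = trans (frobenius-MMᵀ≡MᵀM M)
              (sumFin-cong n (λ k → sumFin-cong n (λ l → cong₂ _*_ (MᵀM≡cI k l) (MᵀM≡cI k l))))

  ΣδA : sumFin² n (λ i j → δ i j * A i j) ≡ Y
  ΣδA = begin
    sumFin² n (λ i j → δ i j * A i j)           ≡⟨ sumFin-cong n (λ i → sumFin-scalarId n c i (A i)) ⟩
    sumFin n (λ i → c * A i i)                  ≡⟨ *-distribˡ-sumFin n c _ ⟨
    c * sumFin n (λ i → A i i)                  ≡⟨ cong (c *_) (trace-MMᵀ≡MᵀM M) ⟩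
    c * sumFin n (λ k → (transpose M ⊗ M) k k)  ≡⟨ cong (c *_) (sumFin-cong n (λ k → MᵀM≡cI k k)) ⟩
    c * sumFin n (λ k → δ k k)                  ≡⟨ *-distribˡ-sumFin n c _ ⟩
    sumFin n (λ k → c * δ k k)                  ≡⟨ sumFin-cong n (λ k → sumFin-scalarId n c k (δ k)) ⟨
    Y                                           ∎

  ΣD² : ℤ
  ΣD² = sumFin² n (λ i j → D i j * D i j)

  -- Σ(A − δ)² = ΣA² − 2ΣδA + Σδ², with the middle term moved across so that nothing is subtracted.
  ΣD²+2Y≡2Y : ΣD² + (Y + Y) ≡ Y + Y
  ΣD²+2Y≡2Y = begin
    ΣD² + (Y + Y)
      ≡⟨ cong (λ x → ΣD² + x) (cong₂ _+_ ΣδA ΣδA) ⟨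
    ΣD² + (sumFin² n (λ i j → δ i j * A i j) + sumFin² n (λ i j → δ i j * A i j))
      ≡⟨ cong (λ x → ΣD² + x) (sumFin²-distrib-+ n _ _) ⟨
    ΣD² + sumFin² n (λ i j → δ i j * A i j + δ i j * A i j)
      ≡⟨ sumFin²-distrib-+ n _ _ ⟨
    sumFin² n (λ i j → D i j * D i j + (δ i j * A i j + δ i j * A i j))
      ≡⟨ sumFin-cong n (λ i → sumFin-cong n (λ j → expand (A i j) (δ i j))) ⟩
    sumFin² n (λ i j → A i j * A i j + δ i j * δ i j)
      ≡⟨ sumFin²-distrib-+ n _ _ ⟩
    sumFin² n (λ i j → A i j * A i j) + Y
      ≡⟨ cong (_+ Y) ΣA² ⟩
    Y + Y ∎
    where
    expand : ∀ a d → (a - d) * (a - d) + (d * a + d * a) ≡ a * a + d * d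
    expand = solve 2 (λ a d → (a :- d) :* (a :- d) :+ (d :* a :+ d :* a) := a :* a :+ d :* d) refl

  rowSumD²≡0 : ∀ i → sumFin n (λ j → D i j * D i j) ≡ 0ℤ
  rowSumD²≡0 = sumFin-nonneg≡0 n _ (λ i → sumFin-nonneg n _ (λ j → square-nonneg (D i j)))
                 (∙-cancelʳ (Y + Y) ΣD² 0ℤ (trans ΣD²+2Y≡2Y (sym (ℤP.+-identityˡ (Y + Y)))))

  D²≡0 : ∀ i j → D i j * D i j ≡ 0ℤ
  D²≡0 i = sumFin-nonneg≡0 n _ (λ j → square-nonneg (D i j)) (rowSumD²≡0 i)

data IsSign : ℤ → Set where
  sign+ : IsSign 1ℤ
  sign- : IsSign -1ℤ

sign≢0 : ∀ {x} → IsSign x → x ≢ 0ℤ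
sign≢0 sign+ ()
sign≢0 sign- ()

sign-entry : ∀ {x} → IsSign x → Entry01 x
sign-entry sign+ = inj₂ (inj₁ refl)
sign-entry sign- = inj₂ (inj₂ refl)

sign-* : ∀ {x y} → IsSign x → IsSign y → IsSign (x * y)
sign-* sign+ sign+ = sign+
sign-* sign+ sign- = sign-
sign-* sign- sign+ = sign-
sign-* sign- sign- = sign+

sign-square : ∀ {x} → IsSign x → x * x ≡ 1ℤ
sign-square sign+ = refl
sign-square sign- = refl

sign-cancel : ∀ {x} → IsSign x → ∀ y → x * (x * y) ≡ y
sign-cancel {x} x± y = trans (sym (ℤP.*-assoc x x y)) (trans (cong (_* y) (sign-square x±)) (ℤP.*-identityˡ y))

entry-view : ∀ {x} → Entry01 x → x ≡ 0ℤ ⊎ IsSign x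
entry-view (inj₁ x≡0)         = inj₁ x≡0
entry-view (inj₂ (inj₁ refl)) = inj₂ sign+
entry-view (inj₂ (inj₂ refl)) = inj₂ sign-

entry≢0⇒sign : ∀ {x} → Entry01 x → x ≢ 0ℤ → IsSign x
entry≢0⇒sign e x≢0 with entry-view e
... | inj₁ x≡0 = ⊥-elim (x≢0 x≡0)
... | inj₂ s   = s

sign-*-entry : ∀ {x y} → IsSign x → Entry01 y → Entry01 (x * y)
sign-*-entry {x} s e with entry-view e
... | inj₁ refl = inj₁ (ℤP.*-zeroʳ x)
... | inj₂ t    = sign-entry (sign-* s t)

entry-*≡0 : ∀ {x y} → Entry01 x → Entry01 y → (x ≢ 0ℤ → y ≢ 0ℤ → ⊥) → x * y ≡ 0ℤ
entry-*≡0 {x} ex ey not-both with entry-view ex | entry-view ey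
... | inj₁ refl | _         = refl
... | inj₂ _    | inj₁ refl = ℤP.*-zeroʳ x
... | inj₂ sx   | inj₂ sy   = ⊥-elim (not-both (sign≢0 sx) (sign≢0 sy))

nonzero?≡true⇒≢0 : ∀ {x} → nonzero? x ≡ true → x ≢ 0ℤ
nonzero?≡true⇒≢0 () refl

≢0⇒nonzero?≡true : ∀ {x} → x ≢ 0ℤ → nonzero? x ≡ true
≢0⇒nonzero?≡true {+ zero}     x≢0 = ⊥-elim (x≢0 refl)
≢0⇒nonzero?≡true {+ suc _}    _   = refl
≢0⇒nonzero?≡true {ℤ.-[1+ _ ]} _   = refl

entry-square : ∀ {x} → Entry01 x → x * x ≡ + (if nonzero? x then 1 else 0)
entry-square (inj₁ refl)        = refl
entry-square (inj₂ (inj₁ refl)) = refl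
entry-square (inj₂ (inj₂ refl)) = refl

orthogonal-signs : ∀ {x y u v} → IsSign x → IsSign y → IsSign u → IsSign v →
  x * y + u * v ≡ 0ℤ → (x * u) * (y * v) ≡ -1ℤ
orthogonal-signs {x} {y} {u} {v} _ _ su sv xy+uv≡0 = begin
  (x * u) * (y * v)      ≡⟨ solve 4 (λ x y u v → (x :* u) :* (y :* v) := (x :* y) :* (u :* v)) refl x y u v ⟩
  (x * y) * (u * v)      ≡⟨ cong (_* (u * v)) (inverseˡ-unique (x * y) (u * v) xy+uv≡0) ⟩
  - (u * v) * (u * v)    ≡⟨ ℤP.neg-distribˡ-* (u * v) (u * v) ⟨
  - ((u * v) * (u * v))  ≡⟨ cong -_ (sign-square (sign-* su sv)) ⟩
  -1ℤ                    ∎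
  where open ≡-Reasoning

no-three-pairwise-opposite-signs : ∀ {a b c} → IsSign a → IsSign b → IsSign c →
  a * b ≡ -1ℤ → a * c ≡ -1ℤ → b * c ≡ -1ℤ → ⊥
no-three-pairwise-opposite-signs sign+ sign+ _     ()
no-three-pairwise-opposite-signs sign- sign- _     ()
no-three-pairwise-opposite-signs sign+ _     sign+ _ ()
no-three-pairwise-opposite-signs sign- _     sign- _ ()
no-three-pairwise-opposite-signs _     sign+ sign+ _ _ ()
no-three-pairwise-opposite-signs _     sign- sign- _ _ ()

-- Counting the points of a boolean predicate

rank : ∀ {n} (p : Fin n → Bool) (c : Fin n) → p c ≡ true → Fin (countFin n p)
rank p zero pc with p zero
... | true = zero
rank p zero () | false
rank p (suc c) pc with p zero
... | true  = suc (rank (λ l → p (suc l)) c pc)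
... | false = rank (λ l → p (suc l)) c pc

rank-injective : ∀ {n} (p : Fin n → Bool) {c d : Fin n} (pc : p c ≡ true) (pd : p d ≡ true) →
  rank p c pc ≡ rank p d pd → c ≡ d
rank-injective p {zero} {zero} pc pd eq = refl
rank-injective p {zero} {suc d} pc pd eq with p zero
rank-injective p {zero} {suc d} pc pd () | true
rank-injective p {zero} {suc d} () pd eq | false
rank-injective p {suc c} {zero} pc pd eq with p zero
rank-injective p {suc c} {zero} pc pd () | true
rank-injective p {suc c} {zero} pc () eq | false
rank-injective p {suc c} {suc d} pc pd eq with p zero
... | true  = cong suc (rank-injective (λ l → p (suc l)) pc pd (suc-injective eq))
... | false = cong suc (rank-injective (λ l → p (suc l)) pc pd eq)

injection⇒≤countFin : ∀ {m n} (p : Fin n → Bool) (g : Fin m → Fin n) →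
  (∀ {i j} → g i ≡ g j → i ≡ j) → (∀ i → p (g i) ≡ true) → m ≤ countFin n p
injection⇒≤countFin p g g-inj pg =
  injective⇒≤ (λ {i} {j} eq → g-inj (rank-injective p (pg i) (pg j) eq))

enumerate : ∀ n (p : Fin n → Bool) → Fin (countFin n p) → Fin n
enumerate (suc n) p i with p zero
enumerate (suc n) p zero    | true  = zero
enumerate (suc n) p (suc i) | true  = suc (enumerate n (λ l → p (suc l)) i)
enumerate (suc n) p i       | false = suc (enumerate n (λ l → p (suc l)) i)

enumerate-sound : ∀ n (p : Fin n → Bool) i → p (enumerate n p i) ≡ true
enumerate-sound (suc n) p i with p zero in p0
enumerate-sound (suc n) p zero    | true  = p0
enumerate-sound (suc n) p (suc i) | true  = enumerate-sound n (λ l → p (suc l)) i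
enumerate-sound (suc n) p i       | false = enumerate-sound n (λ l → p (suc l)) i

enumerate-injective : ∀ n (p : Fin n → Bool) {i j} → enumerate n p i ≡ enumerate n p j → i ≡ j
enumerate-injective (suc n) p {i} {j} eq with p zero
enumerate-injective (suc n) p {zero}  {zero}  eq | true  = refl
enumerate-injective (suc n) p {suc i} {suc j} eq | true  =
  cong suc (enumerate-injective n (λ l → p (suc l)) (suc-injective eq))
enumerate-injective (suc n) p {i}     {j}     eq | false =
  enumerate-injective n (λ l → p (suc l)) (suc-injective eq)

countFin≥2⇒other : ∀ n (p : Fin n → Bool) → 2 ≤ countFin n p → (γ : Fin n) →
  Σ (Fin n) λ c → c ≢ γ × p c ≡ true
countFin≥2⇒other n p 2≤count γ = pick (enumerate n p first ≟ γ)
  where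
  first second : Fin (countFin n p)
  first  = fromℕ< (ℕP.<-≤-trans (s≤s z≤n) 2≤count)
  second = fromℕ< 2≤count
  first≢second : first ≢ second
  first≢second eq with trans (sym (toℕ-fromℕ< _)) (trans (cong toℕ eq) (toℕ-fromℕ< 2≤count))
  ... | ()
  pick : Dec (enumerate n p first ≡ γ) → Σ (Fin n) λ c → c ≢ γ × p c ≡ true
  pick (no  first≢γ) = enumerate n p first , first≢γ , enumerate-sound n p first
  pick (yes first≡γ) = enumerate n p second ,
    (λ second≡γ → first≢second (enumerate-injective n p (trans first≡γ (sym second≡γ)))) ,
    enumerate-sound n p second

countFin-nonzero : ∀ n (f : Fin n → ℤ) → (∀ l → Entry01 (f l)) →
  sumFin n (λ l → f l * f l) ≡ + countFin n (λ l → nonzero? (f l))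
countFin-nonzero zero    f entries = refl
countFin-nonzero (suc n) f entries =
  trans (cong₂ _+_ (entry-square (entries zero)) (countFin-nonzero n (λ l → f (suc l)) (λ l → entries (suc l))))
        (+-homo (nonzero? (f zero)))
  where
  +-homo : ∀ b → + (if b then 1 else 0) + + countFin n (λ l → nonzero? (f (suc l)))
               ≡ + ((if b then 1 else 0) ℕ.+ countFin n (λ l → nonzero? (f (suc l))))
  +-homo true  = refl
  +-homo false = refl

injection-onto : ∀ {n r} (p : Fin n → Bool) → countFin n p ≡ r → (g : Fin r → Fin n) →
  (∀ {i j} → g i ≡ g j → i ≡ j) → (∀ i → p (g i) ≡ true) →
  ∀ y → p y ≡ true → Σ (Fin r) λ j → g j ≡ y
injection-onto {n} {r} p count≡r g g-inj pg y py with any? (λ j → g j ≟ y)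
... | yes hit = hit
... | no  miss = ⊥-elim (ℕP.<-irrefl (sym count≡r) (injection⇒≤countFin p h h-inj ph))
  where
  h : Fin (suc r) → Fin n
  h zero    = y
  h (suc j) = g j
  h-inj : ∀ {i j} → h i ≡ h j → i ≡ j
  h-inj {zero}  {zero}  _  = refl
  h-inj {zero}  {suc j} eq = ⊥-elim (miss (j , sym eq))
  h-inj {suc i} {zero}  eq = ⊥-elim (miss (i , eq))
  h-inj {suc i} {suc j} eq = cong suc (g-inj eq)
  ph : ∀ i → p (h i) ≡ true
  ph zero    = py
  ph (suc j) = pg j

point⇒1≤countFin : ∀ {n} (p : Fin n → Bool) {c} → p c ≡ true → 1 ≤ countFin n p
point⇒1≤countFin p {c} pc = injection⇒≤countFin p (λ (_ : Fin 1) → c) (λ { {zero} {zero} _ → refl }) (λ _ → pc)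

three-points⇒3≤countFin : ∀ {n} (p : Fin n → Bool) {a b c} → a ≢ b → a ≢ c → b ≢ c →
  p a ≡ true → p b ≡ true → p c ≡ true → 3 ≤ countFin n p
three-points⇒3≤countFin p {a} {b} {c} a≢b a≢c b≢c pa pb pc = injection⇒≤countFin p g g-inj pg
  where
  g : Fin 3 → Fin _
  g zero             = a
  g (suc zero)       = b
  g (suc (suc zero)) = c
  g-inj : ∀ {i j} → g i ≡ g j → i ≡ j
  g-inj {zero}             {zero}             _  = refl
  g-inj {zero}             {suc zero}         eq = ⊥-elim (a≢b eq)
  g-inj {zero}             {suc (suc zero)}   eq = ⊥-elim (a≢c eq)
  g-inj {suc zero}         {zero}             eq = ⊥-elim (a≢b (sym eq))
  g-inj {suc zero}         {suc zero}         _  = refl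
  g-inj {suc zero}         {suc (suc zero)}   eq = ⊥-elim (b≢c eq)
  g-inj {suc (suc zero)}   {zero}             eq = ⊥-elim (a≢c (sym eq))
  g-inj {suc (suc zero)}   {suc zero}         eq = ⊥-elim (b≢c (sym eq))
  g-inj {suc (suc zero)}   {suc (suc zero)}   _  = refl
  pg : ∀ i → p (g i) ≡ true
  pg zero             = pa
  pg (suc zero)       = pb
  pg (suc (suc zero)) = pc

-- Permutations and signed permutation matrices

⟨$⟩ʳ-injective : ∀ {n} (π : Permutation′ n) {x y} → π ⟨$⟩ʳ x ≡ π ⟨$⟩ʳ y → x ≡ y
⟨$⟩ʳ-injective π {x} {y} eq =
  trans (sym (Perm.inverseˡ π)) (trans (cong (π ⟨$⟩ˡ_) eq) (Perm.inverseˡ π))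

transpose-self : ∀ {n} (i j : Fin n) → Perm.transpose i j ⟨$⟩ʳ i ≡ j
transpose-self i j rewrite dec-true (i ≟ i) refl = refl

transpose-fix : ∀ {n} {i j k : Fin n} → k ≢ i → k ≢ j → Perm.transpose i j ⟨$⟩ʳ k ≡ k
transpose-fix {i = i} {j} {k} k≢i k≢j rewrite dec-false (k ≟ i) k≢i | dec-false (k ≟ j) k≢j = refl

extend-to-permutation : ∀ n m → m ≤ n → (g : Fin n → Fin n) →
  (∀ i j → toℕ i < m → toℕ j < m → g i ≡ g j → i ≡ j) →
  Σ (Permutation′ n) λ π → ∀ i → toℕ i < m → π ⟨$⟩ʳ i ≡ g i
extend-to-permutation n zero    _     g _     = Perm.id , λ _ ()
extend-to-permutation n (suc m) 1+m≤n g g-inj = π ∘ₚ Perm.transpose u t , agrees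
  where
  IH = extend-to-permutation n m (ℕP.≤-trans (ℕP.n≤1+n m) 1+m≤n) g
         (λ i j i<m j<m → g-inj i j (ℕP.m≤n⇒m≤1+n i<m) (ℕP.m≤n⇒m≤1+n j<m))
  π = proj₁ IH
  π-agrees = proj₂ IH
  new : Fin n
  new = fromℕ< 1+m≤n
  u t : Fin n
  u = π ⟨$⟩ʳ new
  t = g new
  agrees : ∀ i → toℕ i < suc m → Perm.transpose u t ⟨$⟩ʳ (π ⟨$⟩ʳ i) ≡ g i
  agrees i i<1+m with toℕ i ℕP.≟ m
  ... | yes i≡m rewrite toℕ-injective {i = i} {j = new} (trans i≡m (sym (toℕ-fromℕ< 1+m≤n))) = transpose-self u t
  ... | no  i≢m = trans (cong (Perm.transpose u t ⟨$⟩ʳ_) (π-agrees i i<m)) (transpose-fix gi≢u gi≢t)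
    where
    i<m : toℕ i < m
    i<m = ℕP.≤∧≢⇒< (ℕP.≤-pred i<1+m) i≢m
    i≢new : i ≢ new
    i≢new i≡new = i≢m (trans (cong toℕ i≡new) (toℕ-fromℕ< 1+m≤n))
    gi≢u : g i ≢ u
    gi≢u gi≡u = i≢new (⟨$⟩ʳ-injective π (trans (π-agrees i i<m) gi≡u))
    gi≢t : g i ≢ t
    gi≢t gi≡t = i≢new (g-inj i new (ℕP.m≤n⇒m≤1+n i<m) (ℕP.≤-reflexive (cong suc (toℕ-fromℕ< 1+m≤n))) gi≡t)

signedPermutation : ∀ {n} → Permutation′ n → (Fin n → ℤ) → Matrix n
signedPermutation π s i l = if does (π ⟨$⟩ʳ l ≟ i) then s l else 0ℤ

module _ {n : ℕ} (π : Permutation′ n) (s : Fin n → ℤ) where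

  private
    P = signedPermutation π s

  signedPermutation-hit : ∀ i l → π ⟨$⟩ʳ l ≡ i → P i l ≡ s l
  signedPermutation-hit i l πl≡i rewrite dec-true (π ⟨$⟩ʳ l ≟ i) πl≡i = refl

  signedPermutation-miss : ∀ i l → π ⟨$⟩ʳ l ≢ i → P i l ≡ 0ℤ
  signedPermutation-miss i l πl≢i rewrite dec-false (π ⟨$⟩ʳ l ≟ i) πl≢i = refl

  signedPermutation-support : ∀ i l → P i l ≢ 0ℤ → π ⟨$⟩ʳ l ≡ i
  signedPermutation-support i l Pil≢0 with π ⟨$⟩ʳ l ≟ i
  ... | yes πl≡i = πl≡i
  ... | no  _    = ⊥-elim (Pil≢0 refl)

  private
    miss-off : ∀ i l → l ≢ π ⟨$⟩ˡ i → P i l ≡ 0ℤ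
    miss-off i l l≢ = signedPermutation-miss i l (λ πl≡i → l≢ (trans (sym (Perm.inverseˡ π)) (cong (π ⟨$⟩ˡ_) πl≡i)))

  signedPermutation-⊗ : (X : Matrix n) → ∀ i j → (P ⊗ X) i j ≡ s (π ⟨$⟩ˡ i) * X (π ⟨$⟩ˡ i) j
  signedPermutation-⊗ X i j =
    trans (sumFin-single n _ (π ⟨$⟩ˡ i) (λ l l≢ → trans (cong (_* X l j) (miss-off i l l≢)) (ℤP.*-zeroˡ (X l j))))
          (cong (_* X (π ⟨$⟩ˡ i) j) (signedPermutation-hit i _ (Perm.inverseʳ π)))

  ⊗-transpose-signedPermutation : (X : Matrix n) → ∀ i j →
    (X ⊗ transpose P) i j ≡ X i (π ⟨$⟩ˡ j) * s (π ⟨$⟩ˡ j)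
  ⊗-transpose-signedPermutation X i j =
    trans (sumFin-single n _ (π ⟨$⟩ˡ j) (λ l l≢ → trans (cong (X i l *_) (miss-off j l l≢)) (ℤP.*-zeroʳ (X i l))))
          (cong (X i (π ⟨$⟩ˡ j) *_) (signedPermutation-hit j _ (Perm.inverseʳ π)))

  signedPermutation-isSignedPerm : (∀ l → IsSign (s l)) → IsSignedPerm n P
  signedPermutation-isSignedPerm s± = entries , rows , columns
    where
    entries : ∀ i l → Entry01 (P i l)
    entries i l with π ⟨$⟩ʳ l ≟ i
    ... | yes _ = sign-entry (s± l)
    ... | no  _ = inj₁ refl
    rows : ∀ i → Σ (Fin n) λ l → (P i l ≢ 0ℤ) × (∀ l′ → P i l′ ≢ 0ℤ → l′ ≡ l)
    rows i = π ⟨$⟩ˡ i ,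
      (λ P≡0 → sign≢0 (s± _) (trans (sym (signedPermutation-hit i _ (Perm.inverseʳ π))) P≡0)) ,
      (λ l′ P≢0 → trans (sym (Perm.inverseˡ π)) (cong (π ⟨$⟩ˡ_) (signedPermutation-support i l′ P≢0)))
    columns : ∀ l → Σ (Fin n) λ i → (P i l ≢ 0ℤ) × (∀ i′ → P i′ l ≢ 0ℤ → i′ ≡ i)
    columns l = π ⟨$⟩ʳ l ,
      (λ P≡0 → sign≢0 (s± l) (trans (sym (signedPermutation-hit _ l refl)) P≡0)) ,
      (λ i′ P≢0 → sym (signedPermutation-support i′ l P≢0))

transpose-isSignedPerm : ∀ {n} (P : Matrix n) → IsSignedPerm n P → IsSignedPerm n (transpose P)
transpose-isSignedPerm P (entries , rows , columns) = (λ i j → entries j i) , columns , rows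

module _ {n : ℕ} (W : Matrix n) (σ τ : Permutation′ n) (s t : Fin n → ℤ)
         (s± : ∀ i → IsSign (s i)) (t± : ∀ j → IsSign (t j)) where

  signedRearrangement : Matrix n
  signedRearrangement i j = s i * t j * W (σ ⟨$⟩ʳ i) (τ ⟨$⟩ʳ j)

  private
    N = signedRearrangement

  signedRearrangement-isWeighing : ∀ {r} → IsWeighing n r W → IsWeighing n r N
  signedRearrangement-isWeighing {r} (entries , MᵀM≡rI) =
    (λ i j → sign-*-entry (sign-* (s± i) (t± j)) (entries _ _)) , NᵀN≡rI
    where
    open ≡-Reasoning
    NᵀN≡rI : ∀ i j → (transpose N ⊗ N) i j ≡ scalarId (+ r) i j
    NᵀN≡rI i j = begin
      sumFin n (λ l → N l i * N l j)
        ≡⟨ sumFin-cong n (λ l → drop-row-sign l) ⟩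
      sumFin n (λ l → (t i * t j) * (W (σ ⟨$⟩ʳ l) (τ ⟨$⟩ʳ i) * W (σ ⟨$⟩ʳ l) (τ ⟨$⟩ʳ j)))
        ≡⟨ *-distribˡ-sumFin n (t i * t j) _ ⟨
      (t i * t j) * sumFin n (λ l → W (σ ⟨$⟩ʳ l) (τ ⟨$⟩ʳ i) * W (σ ⟨$⟩ʳ l) (τ ⟨$⟩ʳ j))
        ≡⟨ cong ((t i * t j) *_) (sumFin-permute n (λ l → W l (τ ⟨$⟩ʳ i) * W l (τ ⟨$⟩ʳ j)) σ) ⟩
      (t i * t j) * sumFin n (λ l → W l (τ ⟨$⟩ʳ i) * W l (τ ⟨$⟩ʳ j))
        ≡⟨ cong ((t i * t j) *_) (MᵀM≡rI (τ ⟨$⟩ʳ i) (τ ⟨$⟩ʳ j)) ⟩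
      (t i * t j) * scalarId (+ r) (τ ⟨$⟩ʳ i) (τ ⟨$⟩ʳ j)
        ≡⟨ sign-scalarId (i ≟ j) ⟩
      scalarId (+ r) i j ∎
      where
      drop-row-sign : ∀ l → N l i * N l j ≡ (t i * t j) * (W (σ ⟨$⟩ʳ l) (τ ⟨$⟩ʳ i) * W (σ ⟨$⟩ʳ l) (τ ⟨$⟩ʳ j))
      drop-row-sign l = begin
        N l i * N l j
          ≡⟨ solve 5 (λ a b c x y → (a :* b :* x) :* (a :* c :* y) := (a :* a) :* ((b :* c) :* (x :* y))) refl
               (s l) (t i) (t j) (W (σ ⟨$⟩ʳ l) (τ ⟨$⟩ʳ i)) (W (σ ⟨$⟩ʳ l) (τ ⟨$⟩ʳ j)) ⟩
        (s l * s l) * ((t i * t j) * (W (σ ⟨$⟩ʳ l) (τ ⟨$⟩ʳ i) * W (σ ⟨$⟩ʳ l) (τ ⟨$⟩ʳ j)))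
          ≡⟨ cong (_* _) (sign-square (s± l)) ⟩
        1ℤ * ((t i * t j) * (W (σ ⟨$⟩ʳ l) (τ ⟨$⟩ʳ i) * W (σ ⟨$⟩ʳ l) (τ ⟨$⟩ʳ j)))
          ≡⟨ ℤP.*-identityˡ _ ⟩
        (t i * t j) * (W (σ ⟨$⟩ʳ l) (τ ⟨$⟩ʳ i) * W (σ ⟨$⟩ʳ l) (τ ⟨$⟩ʳ j)) ∎
      sign-scalarId : Dec (i ≡ j) → (t i * t j) * scalarId (+ r) (τ ⟨$⟩ʳ i) (τ ⟨$⟩ʳ j) ≡ scalarId (+ r) i j
      sign-scalarId (yes refl) = begin
        (t i * t i) * scalarId (+ r) (τ ⟨$⟩ʳ i) (τ ⟨$⟩ʳ i)  ≡⟨ cong₂ _*_ (sign-square (t± i)) (scalarId-diag (+ r) (τ ⟨$⟩ʳ i)) ⟩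
        1ℤ * + r                                          ≡⟨ ℤP.*-identityˡ (+ r) ⟩
        + r                                               ≡⟨ scalarId-diag (+ r) i ⟨
        scalarId (+ r) i i                                ∎
      sign-scalarId (no i≢j) = begin
        (t i * t j) * scalarId (+ r) (τ ⟨$⟩ʳ i) (τ ⟨$⟩ʳ j)
          ≡⟨ cong ((t i * t j) *_) (scalarId-off (+ r) (λ eq → i≢j (⟨$⟩ʳ-injective τ eq))) ⟩
        (t i * t j) * 0ℤ     ≡⟨ ℤP.*-zeroʳ (t i * t j) ⟩
        0ℤ                  ≡⟨ scalarId-off (+ r) i≢j ⟨
        scalarId (+ r) i j  ∎

  signedRearrangement-equivalent : Equivalent n W N
  signedRearrangement-equivalent =
    P , Q , signedPermutation-isSignedPerm σ s s± ,
    transpose-isSignedPerm _ (signedPermutation-isSignedPerm τ t t±) , W≡PNQ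
    where
    open ≡-Reasoning
    P Q : Matrix n
    P = signedPermutation σ s
    Q = transpose (signedPermutation τ t)
    NQ : ∀ l j → (N ⊗ Q) l j ≡ s l * W (σ ⟨$⟩ʳ l) j
    NQ l j = begin
      (N ⊗ Q) l j                                  ≡⟨ ⊗-transpose-signedPermutation τ t N l j ⟩
      s l * t k * W (σ ⟨$⟩ʳ l) (τ ⟨$⟩ʳ k) * t k    ≡⟨ cong (λ c → s l * t k * W (σ ⟨$⟩ʳ l) c * t k) (Perm.inverseʳ τ) ⟩
      s l * t k * W (σ ⟨$⟩ʳ l) j * t k             ≡⟨ solve 3 (λ a b c → a :* b :* c :* b := b :* (b :* (a :* c))) refl
                                                         (s l) (t k) (W (σ ⟨$⟩ʳ l) j) ⟩
      t k * (t k * (s l * W (σ ⟨$⟩ʳ l) j))         ≡⟨ sign-cancel (t± k) _ ⟩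
      s l * W (σ ⟨$⟩ʳ l) j                         ∎
      where k = τ ⟨$⟩ˡ j
    W≡PNQ : ∀ i j → W i j ≡ (P ⊗ (N ⊗ Q)) i j
    W≡PNQ i j = sym (begin
      (P ⊗ (N ⊗ Q)) i j                  ≡⟨ signedPermutation-⊗ σ s (N ⊗ Q) i j ⟩
      s l * (N ⊗ Q) l j                  ≡⟨ cong (s l *_) (NQ l j) ⟩
      s l * (s l * W (σ ⟨$⟩ʳ l) j)       ≡⟨ sign-cancel (s± l) _ ⟩
      W (σ ⟨$⟩ʳ l) j                     ≡⟨ cong (λ c → W c j) (Perm.inverseʳ σ) ⟩
      W i j                              ∎)
      where l = σ ⟨$⟩ˡ i

-- The column layout of T

<ᵇ-true : ∀ {m n} → m < n → (m <ᵇ n) ≡ true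
<ᵇ-true m<n = Equivalence.to T-≡ (ℕP.<⇒<ᵇ m<n)

<ᵇ-false : ∀ {m n} → n ≤ m → (m <ᵇ n) ≡ false
<ᵇ-false {m} {n} n≤m with m <ᵇ n in m<ᵇn
... | false = refl
... | true  = ⊥-elim (ℕP.<⇒≱ (ℕP.<ᵇ⇒< m n (Equivalence.from T-≡ m<ᵇn)) n≤m)

≡ᵇ-refl : ∀ m → (m ≡ᵇ m) ≡ true
≡ᵇ-refl zero    = refl
≡ᵇ-refl (suc m) = ≡ᵇ-refl m

≡ᵇ-false : ∀ {m n} → m ≢ n → (m ≡ᵇ n) ≡ false
≡ᵇ-false {zero}  {zero}  m≢n = ⊥-elim (m≢n refl)
≡ᵇ-false {zero}  {suc n} _   = refl
≡ᵇ-false {suc m} {zero}  _   = refl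
≡ᵇ-false {suc m} {suc n} m≢n = ≡ᵇ-false (λ m≡n → m≢n (cong suc m≡n))

≡ᵇ-sym : ∀ m n → (m ≡ᵇ n) ≡ (n ≡ᵇ m)
≡ᵇ-sym zero    zero    = refl
≡ᵇ-sym zero    (suc n) = refl
≡ᵇ-sym (suc m) zero    = refl
≡ᵇ-sym (suc m) (suc n) = ≡ᵇ-sym m n

data Column : Set where
  apex  : Column
  pair  : ℕ → ℕ → Column
  blank : Column

columnEntry : ℕ → Column → ℤ
columnEntry a apex       = 1ℤ
columnEntry a (pair p q) = if a ≡ᵇ p then 1ℤ else if a ≡ᵇ q then -1ℤ else 0ℤ
columnEntry a blank      = 0ℤ

-- Group i (0-based row index) of the columns after the first r holds the pairs (i, q) with i < q < r.
groupSize : ℕ → ℕ → ℕ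
groupSize r i = r ∸ i ∸ 1

groupColumn : (r i m d : ℕ) → Column
groupColumn r i zero    d = blank
groupColumn r i (suc m) d =
  if d <ᵇ groupSize r i then pair i (i ℕ.+ d ℕ.+ 1) else groupColumn r (suc i) m (d ∸ groupSize r i)

groupsWidth : (r i m : ℕ) → ℕ
groupsWidth r i zero    = 0
groupsWidth r i (suc m) = groupSize r i ℕ.+ groupsWidth r (suc i) m

columnOf : ℕ → ℕ → Column
columnOf r zero    = apex
columnOf r (suc c) = if suc c <ᵇ r then pair 0 (suc c) else groupColumn r 1 (r ∸ 2) (suc c ∸ r)

Tgroups≡columnEntry : ∀ r i m d a → Tgroups r i m d a ≡ columnEntry a (groupColumn r i m d)
Tgroups≡columnEntry r i zero    d a = refl
Tgroups≡columnEntry r i (suc m) d a with d <ᵇ groupSize r i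
... | true  = refl
... | false = Tgroups≡columnEntry r (suc i) m (d ∸ groupSize r i) a

T≡columnEntry : ∀ {r} k a c → a < r → T r k a c ≡ columnEntry a (columnOf r c)
T≡columnEntry {suc r} k a zero a<r with a ≡ᵇ 0
... | true  = refl
... | false = refl
T≡columnEntry {r} k a (suc c) a<r with suc c ℕP.<? r
... | yes c<r rewrite <ᵇ-true c<r | ≡ᵇ-sym (suc c) a = refl
... | no  c≮r rewrite <ᵇ-false (ℕP.≮⇒≥ c≮r) = Tgroups≡columnEntry r 1 (r ∸ 2) (suc c ∸ r) a

i<i+d+1 : ∀ i d → i < i ℕ.+ d ℕ.+ 1
i<i+d+1 i d = subst (i <_) (ℕP.+-comm 1 (i ℕ.+ d)) (s≤s (ℕP.m≤m+n i d))

<groupSize⇒<r : ∀ r i d → d < groupSize r i → i ℕ.+ d ℕ.+ 1 < r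
<groupSize⇒<r (suc r) zero    d d<size = s≤s (subst (_≤ r) (ℕP.+-comm 1 d) d<size)
<groupSize⇒<r zero    zero    d ()
<groupSize⇒<r zero    (suc i) d ()
<groupSize⇒<r (suc r) (suc i) d d<size = s≤s (<groupSize⇒<r r i d d<size)

groupColumn-bounds : ∀ r i m d {p q} → groupColumn r i m d ≡ pair p q → i ≤ p × p < q × q < r
groupColumn-bounds r i (suc m) d eq with d ℕP.<? groupSize r i
... | yes d<size rewrite <ᵇ-true d<size with eq
...   | refl = ℕP.≤-refl , i<i+d+1 i d , <groupSize⇒<r r i d d<size
groupColumn-bounds r i (suc m) d eq | no d≮size rewrite <ᵇ-false (ℕP.≮⇒≥ d≮size)
  with groupColumn-bounds r (suc i) m _ eq
... | i<p , p<q , q<r = ℕP.<⇒≤ i<p , p<q , q<r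

groupColumn-pair : ∀ r i m d → d < groupsWidth r i m → Σ ℕ λ p → Σ ℕ λ q → groupColumn r i m d ≡ pair p q
groupColumn-pair r i (suc m) d d<width with d ℕP.<? groupSize r i
... | yes d<size rewrite <ᵇ-true d<size = i , i ℕ.+ d ℕ.+ 1 , refl
... | no  d≮size rewrite <ᵇ-false (ℕP.≮⇒≥ d≮size) =
  groupColumn-pair r (suc i) m (d ∸ groupSize r i)
    (ℕP.+-cancelˡ-< (groupSize r i) _ _ (subst (_< groupsWidth r i (suc m)) (sym (ℕP.m+[n∸m]≡n (ℕP.≮⇒≥ d≮size))) d<width))

groupColumn-blank : ∀ r i m d → groupsWidth r i m ≤ d → groupColumn r i m d ≡ blank
groupColumn-blank r i zero    d _ = refl
groupColumn-blank r i (suc m) d width≤d with d ℕP.<? groupSize r i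
... | yes d<size = ⊥-elim (ℕP.<⇒≱ d<size (ℕP.≤-trans (ℕP.m≤m+n _ _) width≤d))
... | no  d≮size rewrite <ᵇ-false (ℕP.≮⇒≥ d≮size) =
  groupColumn-blank r (suc i) m (d ∸ groupSize r i)
    (ℕP.+-cancelˡ-≤ (groupSize r i) _ _ (subst (groupsWidth r i (suc m) ≤_) (sym (ℕP.m+[n∸m]≡n (ℕP.≮⇒≥ d≮size))) width≤d))

pair-injectiveʳ : ∀ {p p′ q q′} → pair p q ≡ pair p′ q′ → q ≡ q′
pair-injectiveʳ refl = refl

groupColumn-injective : ∀ r i m d d′ {p q} → groupColumn r i m d ≡ pair p q → groupColumn r i m d′ ≡ pair p q → d ≡ d′
groupColumn-injective r i (suc m) d d′ eq eq′ with d ℕP.<? groupSize r i | d′ ℕP.<? groupSize r i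
... | yes d<size | yes d′<size rewrite <ᵇ-true d<size | <ᵇ-true d′<size =
  ℕP.+-cancelˡ-≡ i d d′ (ℕP.+-cancelʳ-≡ 1 (i ℕ.+ d) (i ℕ.+ d′) (pair-injectiveʳ (trans eq (sym eq′))))
groupColumn-injective r i (suc m) d d′ eq eq′ | yes d<size | no d′≮size
  rewrite <ᵇ-true d<size | <ᵇ-false (ℕP.≮⇒≥ d′≮size) with eq
... | refl = ⊥-elim (ℕP.n≮n i (proj₁ (groupColumn-bounds r (suc i) m _ eq′)))
groupColumn-injective r i (suc m) d d′ eq eq′ | no d≮size | yes d′<size
  rewrite <ᵇ-false (ℕP.≮⇒≥ d≮size) | <ᵇ-true d′<size with eq′
... | refl = ⊥-elim (ℕP.n≮n i (proj₁ (groupColumn-bounds r (suc i) m _ eq)))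
groupColumn-injective r i (suc m) d d′ eq eq′ | no d≮size | no d′≮size
  rewrite <ᵇ-false (ℕP.≮⇒≥ d≮size) | <ᵇ-false (ℕP.≮⇒≥ d′≮size) =
  ℕP.∸-cancelʳ-≡ (ℕP.≮⇒≥ d≮size) (ℕP.≮⇒≥ d′≮size) (groupColumn-injective r (suc i) m _ _ eq eq′)

∸-mono-< : ∀ p q r → p < q → q < r → q ∸ p ∸ 1 < r ∸ p ∸ 1
∸-mono-< zero    (suc q) (suc r) _         (s≤s q<r) = q<r
∸-mono-< (suc p) (suc q) (suc r) (s≤s p<q) (s≤s q<r) = ∸-mono-< p q r p<q q<r

p+[q∸p∸1]+1≡q : ∀ p q → p < q → p ℕ.+ (q ∸ p ∸ 1) ℕ.+ 1 ≡ q
p+[q∸p∸1]+1≡q zero    (suc q) _         = ℕP.+-comm q 1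
p+[q∸p∸1]+1≡q (suc p) (suc q) (s≤s p<q) = cong suc (p+[q∸p∸1]+1≡q p q p<q)

groupColumn-onto : ∀ r i m {p q} → i ≤ p → p < q → q < r → r ≤ i ℕ.+ m ℕ.+ 1 →
  Σ ℕ λ d → d < groupsWidth r i m × groupColumn r i m d ≡ pair p q
groupColumn-onto r i zero {p} {q} i≤p p<q q<r r≤i+0+1 = ⊥-elim (ℕP.<⇒≱ i<q q≤i)
  where
  i<q : i < q
  i<q = ℕP.≤-<-trans i≤p p<q
  q≤i : q ≤ i
  q≤i = ℕP.≤-pred (ℕP.<-≤-trans q<r (subst (r ≤_) (trans (cong (ℕ._+ 1) (ℕP.+-identityʳ i)) (ℕP.+-comm i 1)) r≤i+0+1))
groupColumn-onto r i (suc m) {p} {q} i≤p p<q q<r r≤ with p ℕP.≟ i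
... | yes refl = q ∸ p ∸ 1 , ℕP.<-≤-trans offset<size (ℕP.m≤m+n _ _) , column
  where
  offset<size : q ∸ p ∸ 1 < groupSize r p
  offset<size = ∸-mono-< p q r p<q q<r
  column : groupColumn r p (suc m) (q ∸ p ∸ 1) ≡ pair p q
  column rewrite <ᵇ-true offset<size = cong (pair p) (p+[q∸p∸1]+1≡q p q p<q)
... | no  p≢i with groupColumn-onto r (suc i) m (ℕP.≤∧≢⇒< i≤p (λ i≡p → p≢i (sym i≡p))) p<q q<r
                     (subst (r ≤_) (cong (ℕ._+ 1) (ℕP.+-suc i m)) r≤)
...   | d , d<width , column = groupSize r i ℕ.+ d , ℕP.+-monoʳ-< (groupSize r i) d<width , column′
  where
  column′ : groupColumn r i (suc m) (groupSize r i ℕ.+ d) ≡ pair p q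
  column′ rewrite <ᵇ-false (ℕP.m≤m+n (groupSize r i) d) | ℕP.m+n∸m≡n (groupSize r i) d = column

groupsWidth≡C2 : ∀ r i m → r ≡ i ℕ.+ m ℕ.+ 1 → groupsWidth r i m ≡ suc m C 2
groupsWidth≡C2 r i zero    _ = refl
groupsWidth≡C2 r i (suc m) r≡ = begin
  groupSize r i ℕ.+ groupsWidth r (suc i) m
    ≡⟨ cong₂ ℕ._+_ (trans (cong (λ x → x ∸ i ∸ 1) r≡) (i+x+1∸i∸1≡x i (suc m)))
                 (groupsWidth≡C2 r (suc i) m (trans r≡ (cong (ℕ._+ 1) (ℕP.+-suc i m)))) ⟩
  suc m ℕ.+ suc m C 2     ≡⟨ cong (ℕ._+ suc m C 2) (nC1≡n (suc m)) ⟨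
  suc m C 1 ℕ.+ suc m C 2 ≡⟨ nCk+nC[k+1]≡[n+1]C[k+1] (suc m) 1 ⟩
  suc (suc m) C 2       ∎
  where
  open ≡-Reasoning
  i+x+1∸i∸1≡x : ∀ i x → i ℕ.+ x ℕ.+ 1 ∸ i ∸ 1 ≡ x
  i+x+1∸i∸1≡x zero    x = ℕP.m+n∸n≡m x 1
  i+x+1∸i∸1≡x (suc i) x = i+x+1∸i∸1≡x i x

r+groupsWidth≡L : ∀ r → 1 ≤ r → r ℕ.+ groupsWidth r 1 (r ∸ 2) ≡ r C 2 ℕ.+ 1
r+groupsWidth≡L (suc zero)    _ = refl
r+groupsWidth≡L (suc (suc r)) _ = begin
  suc (suc r) ℕ.+ groupsWidth (suc (suc r)) 1 r ≡⟨ cong (suc (suc r) ℕ.+_) (groupsWidth≡C2 (suc (suc r)) 1 r (cong suc (ℕP.+-comm 1 r))) ⟩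
  suc (suc r) ℕ.+ suc r C 2                     ≡⟨ ℕP.+-comm 1 (suc r ℕ.+ suc r C 2) ⟩
  suc r ℕ.+ suc r C 2 ℕ.+ 1                       ≡⟨ cong (λ x → x ℕ.+ suc r C 2 ℕ.+ 1) (nC1≡n (suc r)) ⟨
  suc r C 1 ℕ.+ suc r C 2 ℕ.+ 1                   ≡⟨ cong (ℕ._+ 1) (nCk+nC[k+1]≡[n+1]C[k+1] (suc r) 1) ⟩
  suc (suc r) C 2 ℕ.+ 1                         ∎
  where open ≡-Reasoning

r≤r+groupsWidth : ∀ r → r ≤ r C 2 ℕ.+ 1
r≤r+groupsWidth zero    = z≤n
r≤r+groupsWidth (suc r) = subst (suc r ≤_) (r+groupsWidth≡L (suc r) (s≤s z≤n)) (ℕP.m≤m+n (suc r) _)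

groupColumn≢apex : ∀ r i m d → groupColumn r i m d ≢ apex
groupColumn≢apex r i (suc m) d eq with d <ᵇ groupSize r i
... | false = groupColumn≢apex r (suc i) m _ eq

L>1⇒1≤r : ∀ r {c} → suc c < r C 2 ℕ.+ 1 → 1 ≤ r
L>1⇒1≤r zero    (s≤s ())
L>1⇒1≤r (suc r) _ = s≤s z≤n

groupPair : ∀ r c → r ≤ suc c → suc c < r C 2 ℕ.+ 1 →
  Σ ℕ λ p → Σ ℕ λ q → groupColumn r 1 (r ∸ 2) (suc c ∸ r) ≡ pair p q × 1 ≤ p × p < q × q < r
groupPair zero    c _   c<L = ⊥-elim (ℕP.<⇒≱ (L>1⇒1≤r 0 c<L) ℕP.≤-refl)
groupPair (suc r) c r≤c c<L with groupColumn-pair (suc r) 1 (suc r ∸ 2) (suc c ∸ suc r) d<width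
  where
  d<width : suc c ∸ suc r < groupsWidth (suc r) 1 (suc r ∸ 2)
  d<width = ℕP.+-cancelˡ-< (suc r) _ _
    (subst₂ _<_ (sym (ℕP.m+[n∸m]≡n r≤c)) (sym (r+groupsWidth≡L (suc r) (s≤s z≤n))) c<L)
... | p , q , eq with groupColumn-bounds (suc r) 1 (suc r ∸ 2) _ eq
...   | 1≤p , p<q , q<r = p , q , eq , 1≤p , p<q , q<r

data Proper (r : ℕ) : Column → Set where
  isApex : Proper r apex
  isPair : ∀ {p q} → p < q → q < r → Proper r (pair p q)

columnOf-proper : ∀ r c → c < r C 2 ℕ.+ 1 → Proper r (columnOf r c)
columnOf-proper r zero _ = isApex
columnOf-proper r (suc c) c<L with suc c ℕP.<? r
... | yes c<r rewrite <ᵇ-true c<r = isPair (s≤s z≤n) c<r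
... | no  c≮r rewrite <ᵇ-false (ℕP.≮⇒≥ c≮r) with groupPair r c (ℕP.≮⇒≥ c≮r) c<L
...   | p , q , eq , _ , p<q , q<r = subst (Proper r) (sym eq) (isPair p<q q<r)

columnOf-blank : ∀ r c → r C 2 ℕ.+ 1 ≤ c → columnOf r c ≡ blank
columnOf-blank r zero L≤0 with subst (_≤ 0) (ℕP.+-comm (r C 2) 1) L≤0
... | ()
columnOf-blank r (suc c) L≤c rewrite <ᵇ-false (ℕP.≤-trans (r≤r+groupsWidth r) L≤c) = blank-group r L≤c
  where
  blank-group : ∀ r → r C 2 ℕ.+ 1 ≤ suc c → groupColumn r 1 (r ∸ 2) (suc c ∸ r) ≡ blank
  blank-group zero    _   = refl
  blank-group (suc r) L≤c = groupColumn-blank (suc r) 1 (suc r ∸ 2) (suc c ∸ suc r)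
    (ℕP.+-cancelˡ-≤ (suc r) _ _ (subst₂ _≤_ (sym L≡) (sym (ℕP.m+[n∸m]≡n r≤c)) L≤c))
    where
    L≡ = r+groupsWidth≡L (suc r) (s≤s z≤n)
    r≤c : suc r ≤ suc c
    r≤c = ℕP.≤-trans (r≤r+groupsWidth (suc r)) L≤c

columnOf-suc≢apex : ∀ r c → columnOf r (suc c) ≢ apex
columnOf-suc≢apex r c eq with suc c <ᵇ r
... | false = groupColumn≢apex r 1 (r ∸ 2) (suc c ∸ r) eq

pair-injectiveˡ : ∀ {p p′ q q′} → pair p q ≡ pair p′ q′ → p ≡ p′
pair-injectiveˡ refl = refl

columnOf-injective : ∀ r {c c′} → c < r C 2 ℕ.+ 1 → c′ < r C 2 ℕ.+ 1 → columnOf r c ≡ columnOf r c′ → c ≡ c′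
columnOf-injective r {zero}  {zero}   _ _ _  = refl
columnOf-injective r {zero}  {suc c′} _ _ eq = ⊥-elim (columnOf-suc≢apex r c′ (sym eq))
columnOf-injective r {suc c} {zero}   _ _ eq = ⊥-elim (columnOf-suc≢apex r c eq)
columnOf-injective r {suc c} {suc c′} c<L c′<L eq with suc c ℕP.<? r | suc c′ ℕP.<? r
... | yes c<r | yes c′<r rewrite <ᵇ-true c<r | <ᵇ-true c′<r = pair-injectiveʳ eq
... | yes c<r | no  c′≮r rewrite <ᵇ-true c<r | <ᵇ-false (ℕP.≮⇒≥ c′≮r)
  with groupPair r c′ (ℕP.≮⇒≥ c′≮r) c′<L
...   | p , q , eq′ , 1≤p , _ = ⊥-elim (ℕP.<⇒≢ 1≤p (pair-injectiveˡ (trans eq eq′)))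
columnOf-injective r {suc c} {suc c′} c<L c′<L eq | no c≮r | yes c′<r
  rewrite <ᵇ-false (ℕP.≮⇒≥ c≮r) | <ᵇ-true c′<r with groupPair r c (ℕP.≮⇒≥ c≮r) c<L
...   | p , q , eq′ , 1≤p , _ = ⊥-elim (ℕP.<⇒≢ 1≤p (pair-injectiveˡ (trans (sym eq) eq′)))
columnOf-injective r {suc c} {suc c′} c<L c′<L eq | no c≮r | no c′≮r
  rewrite <ᵇ-false (ℕP.≮⇒≥ c≮r) | <ᵇ-false (ℕP.≮⇒≥ c′≮r) with groupPair r c (ℕP.≮⇒≥ c≮r) c<L
...   | p , q , eq′ , _ =
  ℕP.∸-cancelʳ-≡ (ℕP.≮⇒≥ c≮r) (ℕP.≮⇒≥ c′≮r) (groupColumn-injective r 1 (r ∸ 2) _ _ eq′ (trans (sym eq) eq′))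

columnOf-onto : ∀ r {p q} → p < q → q < r → Σ ℕ λ c → c < r C 2 ℕ.+ 1 × columnOf r c ≡ pair p q
columnOf-onto r {zero} {suc q} _ q<r = suc q , ℕP.<-≤-trans q<r (r≤r+groupsWidth r) , column
  where
  column : columnOf r (suc q) ≡ pair 0 (suc q)
  column rewrite <ᵇ-true q<r = refl
columnOf-onto zero          {suc p} _  ()
columnOf-onto (suc zero)    {suc p} () (s≤s z≤n)
columnOf-onto (suc (suc r)) {suc p} {q} p<q q<r
  with groupColumn-onto (suc (suc r)) 1 r (s≤s z≤n) p<q q<r (ℕP.≤-reflexive (cong suc (ℕP.+-comm 1 r)))
... | d , d<width , column = suc (suc (r ℕ.+ d)) , c<L , column′
  where
  c<L : suc (suc (r ℕ.+ d)) < suc (suc r) C 2 ℕ.+ 1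
  c<L = subst (suc (suc (r ℕ.+ d)) <_) (r+groupsWidth≡L (suc (suc r)) (s≤s z≤n)) (ℕP.+-monoʳ-< (suc (suc r)) d<width)
  column′ : columnOf (suc (suc r)) (suc (suc (r ℕ.+ d))) ≡ pair (suc p) q
  column′ rewrite <ᵇ-false {suc (suc (r ℕ.+ d))} {suc (suc r)} (s≤s (s≤s (ℕP.m≤m+n r d))) | ℕP.m+n∸m≡n r d = column

-- Rows of W through a fixed column γ

module ThroughColumn {n r : ℕ} (W : Matrix n) (weighing : IsWeighing n r W)
  (meet-0-or-2 : ∀ x y → x ≢ y → (intersection W x y ≡ 0) ⊎ (intersection W x y ≡ 2))
  (γ : Fin n) where

  entries : ∀ x c → Entry01 (W x c)
  entries = proj₁ weighing

  rows-orthogonal : ∀ x y → sumFin n (λ l → W x l * W y l) ≡ scalarId (+ r) x y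
  rows-orthogonal = MᵀM≡cI⇒MMᵀ≡cI W (+ r) (proj₂ weighing)

  row-weight : ∀ x → countFin n (λ c → nonzero? (W x c)) ≡ r
  row-weight x = ℤP.+-injective (begin
    + countFin n (λ c → nonzero? (W x c))  ≡⟨ countFin-nonzero n (W x) (entries x) ⟨
    sumFin n (λ l → W x l * W x l)         ≡⟨ rows-orthogonal x x ⟩
    scalarId (+ r) x x                     ≡⟨ scalarId-diag (+ r) x ⟩
    + r                                    ∎)
    where open ≡-Reasoning

  through? : Fin n → Bool
  through? l = nonzero? (W l γ)

  column-weight : countFin n through? ≡ r
  column-weight = ℤP.+-injective (begin
    + countFin n (λ l → nonzero? (W l γ))  ≡⟨ countFin-nonzero n (λ l → W l γ) (λ l → entries l γ) ⟨
    sumFin n (λ l → W l γ * W l γ)         ≡⟨ proj₂ weighing γ γ ⟩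
    scalarId (+ r) γ γ                     ≡⟨ scalarId-diag (+ r) γ ⟩
    + r                                    ∎)
    where open ≡-Reasoning

  Through : Fin n → Set
  Through x = W x γ ≢ 0ℤ

  common : Fin n → Fin n → Fin n → Bool
  common x y c = nonzero? (W x c) ∧ nonzero? (W y c)

  common-intro : ∀ {x y c} → W x c ≢ 0ℤ → W y c ≢ 0ℤ → common x y c ≡ true
  common-intro x≢0 y≢0 rewrite ≢0⇒nonzero?≡true x≢0 | ≢0⇒nonzero?≡true y≢0 = refl

  common-elim : ∀ {x y c} → common x y c ≡ true → W x c ≢ 0ℤ × W y c ≢ 0ℤ
  common-elim {x} {y} {c} eq with nonzero? (W x c) in x≠0 | nonzero? (W y c) in y≠0
  common-elim refl | true | true = nonzero?≡true⇒≢0 x≠0 , nonzero?≡true⇒≢0 y≠0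

  intersection≡2 : ∀ {x y} → x ≢ y → Through x → Through y → intersection W x y ≡ 2
  intersection≡2 {x} {y} x≢y x∋γ y∋γ with meet-0-or-2 x y x≢y
  ... | inj₂ ≡2 = ≡2
  ... | inj₁ ≡0 = ⊥-elim (ℕP.<⇒≢ (point⇒1≤countFin (common x y) (common-intro x∋γ y∋γ)) (sym ≡0))

  -- Junk value γ when x and y have fewer than two common columns.
  secondCommon : Fin n → Fin n → Fin n
  secondCommon x y with 2 ℕP.≤? intersection W x y
  ... | yes 2≤ = proj₁ (countFin≥2⇒other n (common x y) 2≤ γ)
  ... | no  _  = γ

  record SecondCommon (x y c : Fin n) : Set where
    field
      ≢γ  : c ≢ γ
      x≢0 : W x c ≢ 0ℤ
      y≢0 : W y c ≢ 0ℤ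

  secondCommon-spec : ∀ {x y} → x ≢ y → Through x → Through y → SecondCommon x y (secondCommon x y)
  secondCommon-spec {x} {y} x≢y x∋γ y∋γ with 2 ℕP.≤? intersection W x y
  ... | yes 2≤ with countFin≥2⇒other n (common x y) 2≤ γ
  ...   | c , c≢γ , both = record { ≢γ = c≢γ ; x≢0 = proj₁ (common-elim both) ; y≢0 = proj₂ (common-elim both) }
  secondCommon-spec {x} {y} x≢y x∋γ y∋γ | no 2≰ = ⊥-elim (2≰ (ℕP.≤-reflexive (sym (intersection≡2 x≢y x∋γ y∋γ))))

  secondCommon-unique : ∀ {x y c} → x ≢ y → Through x → Through y →
    c ≢ γ → W x c ≢ 0ℤ → W y c ≢ 0ℤ → c ≡ secondCommon x y
  secondCommon-unique {x} {y} {c} x≢y x∋γ y∋γ c≢γ xc≢0 yc≢0 with c ≟ secondCommon x y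
  ... | yes c≡ = c≡
  ... | no  c≢ = ⊥-elim (ℕP.<⇒≱ 3≤ (ℕP.≤-reflexive (intersection≡2 x≢y x∋γ y∋γ)))
    where
    open SecondCommon (secondCommon-spec x≢y x∋γ y∋γ)
    3≤ : 3 ≤ intersection W x y
    3≤ = three-points⇒3≤countFin (common x y) (λ eq → ≢γ (sym eq)) (λ eq → c≢γ (sym eq)) (λ eq → c≢ (sym eq))
           (common-intro x∋γ y∋γ) (common-intro x≢0 y≢0) (common-intro xc≢0 yc≢0)

  secondCommon-sym : ∀ {x y} → x ≢ y → Through x → Through y → secondCommon x y ≡ secondCommon y x
  secondCommon-sym {x} {y} x≢y x∋γ y∋γ = secondCommon-unique {y} {x} (λ eq → x≢y (sym eq)) y∋γ x∋γ ≢γ y≢0 x≢0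
    where open SecondCommon (secondCommon-spec x≢y x∋γ y∋γ)

  orthogonal-at : ∀ {x y c} → x ≢ y → Through x → Through y →
    c ≢ γ → W x c ≢ 0ℤ → W y c ≢ 0ℤ → W x γ * W y γ + W x c * W y c ≡ 0ℤ
  orthogonal-at {x} {y} {c} x≢y x∋γ y∋γ c≢γ xc≢0 yc≢0 = begin
    W x γ * W y γ + W x c * W y c  ≡⟨ sumFin-pair n (λ l → W x l * W y l) (λ γ≡c → c≢γ (sym γ≡c)) vanish ⟨
    sumFin n (λ l → W x l * W y l)  ≡⟨ rows-orthogonal x y ⟩
    scalarId (+ r) x y              ≡⟨ scalarId-off (+ r) x≢y ⟩
    0ℤ                              ∎
    where
    open ≡-Reasoning
    vanish : ∀ l → l ≢ γ → l ≢ c → W x l * W y l ≡ 0ℤ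
    vanish l l≢γ l≢c = entry-*≡0 (entries x l) (entries y l) λ xl≢0 yl≢0 →
      l≢c (trans (secondCommon-unique x≢y x∋γ y∋γ l≢γ xl≢0 yl≢0)
                 (sym (secondCommon-unique x≢y x∋γ y∋γ c≢γ xc≢0 yc≢0)))

  ε : Fin n → Fin n → ℤ
  ε x c = W x γ * W x c

  opposite-at : ∀ {x y c} → x ≢ y → Through x → Through y →
    c ≢ γ → W x c ≢ 0ℤ → W y c ≢ 0ℤ → ε x c * ε y c ≡ -1ℤ
  opposite-at {x} {y} {c} x≢y x∋γ y∋γ c≢γ xc≢0 yc≢0 =
    orthogonal-signs (sign x γ x∋γ) (sign y γ y∋γ) (sign x c xc≢0) (sign y c yc≢0)
      (orthogonal-at x≢y x∋γ y∋γ c≢γ xc≢0 yc≢0)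
    where
    sign : ∀ x c → W x c ≢ 0ℤ → IsSign (W x c)
    sign x c = entry≢0⇒sign (entries x c)

  no-three-through : ∀ {x y z c} → x ≢ y → x ≢ z → y ≢ z → Through x → Through y → Through z →
    c ≢ γ → W x c ≢ 0ℤ → W y c ≢ 0ℤ → W z c ≢ 0ℤ → ⊥
  no-three-through x≢y x≢z y≢z x∋γ y∋γ z∋γ c≢γ xc≢0 yc≢0 zc≢0 =
    no-three-pairwise-opposite-signs (ε-sign x∋γ xc≢0) (ε-sign y∋γ yc≢0) (ε-sign z∋γ zc≢0)
      (opposite-at x≢y x∋γ y∋γ c≢γ xc≢0 yc≢0)
      (opposite-at x≢z x∋γ z∋γ c≢γ xc≢0 zc≢0)
      (opposite-at y≢z y∋γ z∋γ c≢γ yc≢0 zc≢0)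
    where
    ε-sign : ∀ {x c} → Through x → W x c ≢ 0ℤ → IsSign (ε x c)
    ε-sign {x} {c} x∋γ xc≢0 = sign-* (entry≢0⇒sign (entries x γ) x∋γ) (entry≢0⇒sign (entries x c) xc≢0)

  third-vanishes : ∀ {x y z} → x ≢ y → Through x → Through y → Through z →
    z ≢ x → z ≢ y → W z (secondCommon x y) ≡ 0ℤ
  third-vanishes x≢y x∋γ y∋γ z∋γ z≢x z≢y with entry-view (entries _ (secondCommon _ _))
  ... | inj₁ ≡0 = ≡0
  ... | inj₂ s  = ⊥-elim (no-three-through x≢y (λ eq → z≢x (sym eq)) (λ eq → z≢y (sym eq)) x∋γ y∋γ z∋γ
                          ≢γ x≢0 y≢0 (sign≢0 s))
    where open SecondCommon (secondCommon-spec x≢y x∋γ y∋γ)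

  -- Row a (for a < r) is the a-th row through γ; junk value γ otherwise.
  row : ℕ → Fin n
  row a with a ℕP.<? countFin n through?
  ... | yes a<count = enumerate n through? (fromℕ< a<count)
  ... | no  _       = γ

  private
    <r⇒<count : ∀ {a} → a < r → a < countFin n through?
    <r⇒<count a<r = subst (_ <_) (sym column-weight) a<r

    row-enumerate : ∀ {a} (a<r : a < r) → row a ≡ enumerate n through? (fromℕ< (<r⇒<count a<r))
    row-enumerate {a} a<r with a ℕP.<? countFin n through?
    ... | yes _     = refl
    ... | no  a≮cnt = ⊥-elim (a≮cnt (<r⇒<count a<r))

  row-through : ∀ {a} → a < r → Through (row a)
  row-through a<r rewrite row-enumerate a<r = nonzero?≡true⇒≢0 (enumerate-sound n through? _)

  row-injective : ∀ {a b} → a < r → b < r → row a ≡ row b → a ≡ b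
  row-injective {a} {b} a<r b<r eq rewrite row-enumerate a<r | row-enumerate b<r =
    trans (sym (toℕ-fromℕ< (<r⇒<count a<r)))
          (trans (cong toℕ (enumerate-injective n through? eq)) (toℕ-fromℕ< (<r⇒<count b<r)))

  row-distinct : ∀ {a b} → a < r → b < r → a ≢ b → row a ≢ row b
  row-distinct a<r b<r a≢b eq = a≢b (row-injective a<r b<r eq)

  meet : ℕ → ℕ → Fin n
  meet p q = secondCommon (row p) (row q)

  meet-spec : ∀ {p q} → p < r → q < r → p ≢ q → SecondCommon (row p) (row q) (meet p q)
  meet-spec p<r q<r p≢q = secondCommon-spec (row-distinct p<r q<r p≢q) (row-through p<r) (row-through q<r)

  meet-member : ∀ {p q z} → p < r → q < r → p ≢ q → z < r → W (row z) (meet p q) ≢ 0ℤ → z ≡ p ⊎ z ≡ q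
  meet-member {p} {q} {z} p<r q<r p≢q z<r z≢0 with z ℕP.≟ p | z ℕP.≟ q
  ... | yes z≡p | _       = inj₁ z≡p
  ... | no  _   | yes z≡q = inj₂ z≡q
  ... | no  z≢p | no  z≢q = ⊥-elim (z≢0 (third-vanishes (row-distinct p<r q<r p≢q) (row-through p<r) (row-through q<r)
                                          (row-through z<r) (row-distinct z<r p<r z≢p) (row-distinct z<r q<r z≢q)))

  image : Column → Fin n
  image apex       = γ
  image (pair p q) = meet p q
  image blank      = γ

  image-injective : ∀ {x y} → Proper r x → Proper r y → image x ≡ image y → x ≡ y
  image-injective isApex isApex _ = refl
  image-injective isApex (isPair p<q q<r) eq =
    ⊥-elim (SecondCommon.≢γ (meet-spec (ℕP.<-trans p<q q<r) q<r (ℕP.<⇒≢ p<q)) (sym eq))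
  image-injective (isPair p<q q<r) isApex eq =
    ⊥-elim (SecondCommon.≢γ (meet-spec (ℕP.<-trans p<q q<r) q<r (ℕP.<⇒≢ p<q)) eq)
  image-injective (isPair {p} {q} p<q q<r) (isPair {p′} {q′} p′<q′ q′<r) eq
    with meet-member p<r q<r p≢q p′<r (subst (λ c → W (row p′) c ≢ 0ℤ) (sym eq) (SecondCommon.x≢0 spec′))
       | meet-member p<r q<r p≢q q′<r (subst (λ c → W (row q′) c ≢ 0ℤ) (sym eq) (SecondCommon.y≢0 spec′))
    where
    p<r = ℕP.<-trans p<q q<r
    p′<r = ℕP.<-trans p′<q′ q′<r
    p≢q = ℕP.<⇒≢ p<q
    spec′ = meet-spec p′<r q′<r (ℕP.<⇒≢ p′<q′)
  ... | inj₁ refl | inj₂ refl = refl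
  ... | inj₁ refl | inj₁ refl = ⊥-elim (ℕP.<-irrefl refl p′<q′)
  ... | inj₂ refl | inj₂ refl = ⊥-elim (ℕP.<-irrefl refl p′<q′)
  ... | inj₂ refl | inj₁ refl = ⊥-elim (ℕP.<-asym p<q p′<q′)

  -- Junk value 1 for a ≥ r keeps every row sign a unit.
  rowSign : ℕ → ℤ
  rowSign a with a ℕP.<? r
  ... | yes _ = W (row a) γ
  ... | no  _ = 1ℤ

  rowSign-<r : ∀ {a} → a < r → rowSign a ≡ W (row a) γ
  rowSign-<r {a} a<r with a ℕP.<? r
  ... | yes _   = refl
  ... | no  a≮r = ⊥-elim (a≮r a<r)

  rowSign-sign : ∀ a → IsSign (rowSign a)
  rowSign-sign a with a ℕP.<? r
  ... | yes a<r = entry≢0⇒sign (entries (row a) γ) (row-through a<r)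
  ... | no  _   = sign+

  columnSign : Column → ℤ
  columnSign apex       = 1ℤ
  columnSign (pair p q) = rowSign p * W (row p) (meet p q)
  columnSign blank      = 1ℤ

  columnSign-sign : ∀ {x} → Proper r x ⊎ x ≡ blank → IsSign (columnSign x)
  columnSign-sign (inj₁ isApex)           = sign+
  columnSign-sign (inj₁ (isPair p<q q<r)) =
    sign-* (rowSign-sign _) (entry≢0⇒sign (entries _ _) (SecondCommon.x≢0 (meet-spec (ℕP.<-trans p<q q<r) q<r (ℕP.<⇒≢ p<q))))
  columnSign-sign (inj₂ refl)             = sign+

  normalised-entry : ∀ {a x} → a < r → Proper r x → rowSign a * columnSign x * W (row a) (image x) ≡ columnEntry a x
  normalised-entry {a} a<r isApex rewrite rowSign-<r a<r =
    trans (cong (_* W (row a) γ) (ℤP.*-identityʳ (W (row a) γ))) (sign-square (entry≢0⇒sign (entries _ _) (row-through a<r)))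
  normalised-entry {a} a<r (isPair {p} {q} p<q q<r) with a ℕP.≟ p | a ℕP.≟ q
  ... | yes refl | _ rewrite ≡ᵇ-refl a | rowSign-<r a<r = begin
    W (row a) γ * (W (row a) γ * W (row a) m) * W (row a) m
      ≡⟨ solve 2 (λ g c → g :* (g :* c) :* c := (g :* g) :* (c :* c)) refl (W (row a) γ) (W (row a) m) ⟩
    (W (row a) γ * W (row a) γ) * (W (row a) m * W (row a) m)
      ≡⟨ cong₂ _*_ (sign-square (entry≢0⇒sign (entries _ _) (row-through a<r)))
                   (sign-square (entry≢0⇒sign (entries _ _) (SecondCommon.x≢0 spec))) ⟩
    1ℤ ∎
    where
    open ≡-Reasoning
    m = meet a q
    spec = meet-spec a<r q<r (ℕP.<⇒≢ p<q)
  ... | no a≢p | yes refl rewrite ≡ᵇ-false a≢p | ≡ᵇ-refl a | rowSign-<r a<r | rowSign-<r (ℕP.<-trans p<q q<r) = begin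
    W (row a) γ * (W (row p) γ * W (row p) m) * W (row a) m
      ≡⟨ solve 4 (λ a b c d → a :* (b :* c) :* d := (a :* d) :* (b :* c)) refl
           (W (row a) γ) (W (row p) γ) (W (row p) m) (W (row a) m) ⟩
    ε (row a) m * ε (row p) m
      ≡⟨ opposite-at (row-distinct a<r p<r a≢p) (row-through a<r) (row-through p<r) ≢γ y≢0 x≢0 ⟩
    -1ℤ ∎
    where
    open ≡-Reasoning
    p<r = ℕP.<-trans p<q q<r
    m = meet p a
    open SecondCommon (meet-spec p<r a<r (ℕP.<⇒≢ p<q))
  ... | no a≢p | no a≢q rewrite ≡ᵇ-false a≢p | ≡ᵇ-false a≢q =
    trans (cong (rowSign a * columnSign (pair p q) *_)
                (third-vanishes (row-distinct p<r q<r (ℕP.<⇒≢ p<q)) (row-through p<r) (row-through q<r) (row-through a<r)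
                                (row-distinct a<r p<r a≢p) (row-distinct a<r q<r a≢q)))
          (ℤP.*-zeroʳ (rowSign a * columnSign (pair p q)))
    where p<r = ℕP.<-trans p<q q<r

  -- The r non-zero columns of row a: γ, and its second common column with each other row through γ.
  partner : ℕ → ℕ → Fin n
  partner a j with j ℕP.≟ a
  ... | yes _ = γ
  ... | no  _ = meet a j

  partner-nonzero : ∀ {a j} → a < r → j < r → W (row a) (partner a j) ≢ 0ℤ
  partner-nonzero {a} {j} a<r j<r with j ℕP.≟ a
  ... | yes _   = row-through a<r
  ... | no  j≢a = SecondCommon.x≢0 (meet-spec a<r j<r (λ a≡j → j≢a (sym a≡j)))

  partner-injective : ∀ {a j j′} → a < r → j < r → j′ < r → partner a j ≡ partner a j′ → j ≡ j′
  partner-injective {a} {j} {j′} a<r j<r j′<r eq with j ℕP.≟ a | j′ ℕP.≟ a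
  ... | yes j≡a | yes j′≡a = trans j≡a (sym j′≡a)
  ... | yes _   | no  j′≢a = ⊥-elim (SecondCommon.≢γ (meet-spec a<r j′<r (λ a≡j′ → j′≢a (sym a≡j′))) (sym eq))
  ... | no  j≢a | yes _    = ⊥-elim (SecondCommon.≢γ (meet-spec a<r j<r (λ a≡j → j≢a (sym a≡j))) eq)
  ... | no  j≢a | no  j′≢a with j ℕP.≟ j′
  ...   | yes j≡j′ = j≡j′
  ...   | no  j≢j′ = ⊥-elim (no-three-through (row-distinct a<r j<r (λ a≡j → j≢a (sym a≡j)))
                                              (row-distinct a<r j′<r (λ a≡j′ → j′≢a (sym a≡j′)))
                                              (row-distinct j<r j′<r j≢j′)
                                              (row-through a<r) (row-through j<r) (row-through j′<r)
                                              ≢γ x≢0 y≢0 (subst (λ c → W (row j′) c ≢ 0ℤ) (sym eq)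
                                                 (SecondCommon.y≢0 (meet-spec a<r j′<r (λ a≡j′ → j′≢a (sym a≡j′))))))
    where open SecondCommon (meet-spec a<r j<r (λ a≡j → j≢a (sym a≡j)))

  partner-image : ∀ {a j} → a < r → j < r → Σ ℕ λ c → c < r C 2 ℕ.+ 1 × image (columnOf r c) ≡ partner a j
  partner-image {a} {j} a<r j<r with j ℕP.≟ a
  ... | yes _ = 0 , subst (0 <_) (ℕP.+-comm 1 (r C 2)) (s≤s z≤n) , refl
  ... | no  j≢a with ℕP.<-cmp a j
  ...   | tri< a<j _ _ with columnOf-onto r a<j j<r
  ...     | c , c<L , column = c , c<L , cong image column
  partner-image {a} {j} a<r j<r | no j≢a | tri> _ _ j<a with columnOf-onto r j<a a<r
  ...     | c , c<L , column = c , c<L ,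
    trans (cong image column) (secondCommon-sym (row-distinct j<r a<r j≢a) (row-through j<r) (row-through a<r))
  partner-image {a} {j} a<r j<r | no j≢a | tri≈ _ a≡j _ = ⊥-elim (j≢a (sym a≡j))

  row-support : ∀ {a y} → a < r → W (row a) y ≢ 0ℤ → Σ ℕ λ c → c < r C 2 ℕ.+ 1 × image (columnOf r c) ≡ y
  row-support {a} {y} a<r y≢0 with injection-onto (λ c → nonzero? (W (row a) c)) (row-weight (row a))
      (λ j → partner a (toℕ j))
      (λ eq → toℕ-injective (partner-injective a<r (toℕ<n _) (toℕ<n _) eq))
      (λ j → ≢0⇒nonzero?≡true (partner-nonzero a<r (toℕ<n j)))
      y (≢0⇒nonzero?≡true y≢0)
  ... | j , partner≡y with partner-image a<r (toℕ<n j)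
  ...   | c , c<L , image≡partner = c , c<L , trans image≡partner partner≡y

  column : Fin n → Column
  column c = columnOf r (toℕ c)

  row-injection : ∀ (i j : Fin n) → toℕ i < r → toℕ j < r → row (toℕ i) ≡ row (toℕ j) → i ≡ j
  row-injection i j i<r j<r eq = toℕ-injective (row-injective i<r j<r eq)

  column-injection : ∀ (c d : Fin n) → toℕ c < r C 2 ℕ.+ 1 → toℕ d < r C 2 ℕ.+ 1 →
    image (column c) ≡ image (column d) → c ≡ d
  column-injection c d c<L d<L eq = toℕ-injective
    (columnOf-injective r c<L d<L (image-injective (columnOf-proper r _ c<L) (columnOf-proper r _ d<L) eq))

  r≤n : r ≤ n
  r≤n = injective⇒≤ {f = λ (a : Fin r) → row (toℕ a)}
          (λ {a} {b} eq → toℕ-injective (row-injective (toℕ<n a) (toℕ<n b) eq))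

  L≤n : r C 2 ℕ.+ 1 ≤ n
  L≤n = injective⇒≤ {f = λ (c : Fin (r C 2 ℕ.+ 1)) → image (columnOf r (toℕ c))}
          (λ {c} {d} eq → toℕ-injective (columnOf-injective r (toℕ<n c) (toℕ<n d)
                    (image-injective (columnOf-proper r (toℕ c) (toℕ<n c)) (columnOf-proper r (toℕ d) (toℕ<n d)) eq)))

  opaque
    σ τ : Permutation′ n
    σ = proj₁ (extend-to-permutation n r r≤n (λ i → row (toℕ i)) row-injection)
    τ = proj₁ (extend-to-permutation n (r C 2 ℕ.+ 1) L≤n (λ c → image (column c)) column-injection)

    σ-row : ∀ i → toℕ i < r → σ ⟨$⟩ʳ i ≡ row (toℕ i)
    σ-row = proj₂ (extend-to-permutation n r r≤n (λ i → row (toℕ i)) row-injection)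

    τ-image : ∀ c → toℕ c < r C 2 ℕ.+ 1 → τ ⟨$⟩ʳ c ≡ image (column c)
    τ-image = proj₂ (extend-to-permutation n (r C 2 ℕ.+ 1) L≤n (λ c → image (column c)) column-injection)

  s t : Fin n → ℤ
  s i = rowSign (toℕ i)
  t c = columnSign (column c)

  s± : ∀ i → IsSign (s i)
  s± i = rowSign-sign (toℕ i)

  t± : ∀ c → IsSign (t c)
  t± c with toℕ c ℕP.<? r C 2 ℕ.+ 1
  ... | yes c<L = columnSign-sign (inj₁ (columnOf-proper r _ c<L))
  ... | no  c≮L = columnSign-sign (inj₂ (columnOf-blank r _ (ℕP.≮⇒≥ c≮L)))

  normalised : Matrix n
  normalised = signedRearrangement W σ τ s t s± t±

  τ-blank : ∀ c → r C 2 ℕ.+ 1 ≤ toℕ c → ∀ c′ → c′ < r C 2 ℕ.+ 1 → image (columnOf r c′) ≢ τ ⟨$⟩ʳ c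
  τ-blank c L≤c c′ c′<L eq = ℕP.<⇒≱ c′<L (subst (r C 2 ℕ.+ 1 ≤_) toℕc≡c′ L≤c)
    where
    c′<n : c′ < n
    c′<n = ℕP.<-≤-trans c′<L L≤n
    toℕc″ : toℕ (fromℕ< c′<n) ≡ c′
    toℕc″ = toℕ-fromℕ< c′<n
    τc″ : τ ⟨$⟩ʳ fromℕ< c′<n ≡ image (columnOf r c′)
    τc″ = trans (τ-image (fromℕ< c′<n) (subst (_< r C 2 ℕ.+ 1) (sym toℕc″) c′<L))
                (cong (λ x → image (columnOf r x)) toℕc″)
    toℕc≡c′ : toℕ c ≡ c′
    toℕc≡c′ = trans (cong toℕ (⟨$⟩ʳ-injective τ (trans (sym eq) (sym τc″)))) toℕc″

  blank-vanishes : ∀ {a} c → a < r → r C 2 ℕ.+ 1 ≤ toℕ c → W (row a) (τ ⟨$⟩ʳ c) ≡ 0ℤ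
  blank-vanishes {a} c a<r L≤c with entry-view (entries (row a) (τ ⟨$⟩ʳ c))
  ... | inj₁ ≡0 = ≡0
  ... | inj₂ sg = ⊥-elim (not-in-support (row-support {a} {τ ⟨$⟩ʳ c} a<r (sign≢0 sg)))
    where
    not-in-support : ¬ Σ ℕ (λ c′ → c′ < r C 2 ℕ.+ 1 × image (columnOf r c′) ≡ τ ⟨$⟩ʳ c)
    not-in-support (c′ , c′<L , image≡τc) = τ-blank c L≤c c′ c′<L image≡τc

  normalised-first-rows : ∀ a c → toℕ a < r → normalised a c ≡ columnEntry (toℕ a) (column c)
  normalised-first-rows a c a<r with toℕ c ℕP.<? r C 2 ℕ.+ 1
  ... | yes c<L = begin
    s a * t c * W (σ ⟨$⟩ʳ a) (τ ⟨$⟩ʳ c)              ≡⟨ cong₂ (λ x y → s a * t c * W x y) (σ-row a a<r) (τ-image c c<L) ⟩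
    s a * t c * W (row (toℕ a)) (image (column c))   ≡⟨ normalised-entry a<r (columnOf-proper r (toℕ c) c<L) ⟩
    columnEntry (toℕ a) (column c)                   ∎
    where open ≡-Reasoning
  ... | no  c≮L = begin
    s a * t c * W (σ ⟨$⟩ʳ a) (τ ⟨$⟩ʳ c)  ≡⟨ cong (λ x → s a * t c * W x (τ ⟨$⟩ʳ c)) (σ-row a a<r) ⟩
    s a * t c * W (row (toℕ a)) (τ ⟨$⟩ʳ c) ≡⟨ cong (s a * t c *_) (blank-vanishes c a<r (ℕP.≮⇒≥ c≮L)) ⟩
    s a * t c * 0ℤ                        ≡⟨ ℤP.*-zeroʳ (s a * t c) ⟩
    0ℤ                                    ≡⟨ cong (columnEntry (toℕ a)) (columnOf-blank r (toℕ c) (ℕP.≮⇒≥ c≮L)) ⟨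
    columnEntry (toℕ a) (column c)        ∎
    where open ≡-Reasoning

lemma3p3 : (n r : ℕ) (W : Matrix n) →
    IsWeighing n r W →
    (∀ i j → i ≢ j → (intersection W i j ≡ 0) ⊎ (intersection W i j ≡ 2)) →
    let k = n ∸ (r C 2) ∸ 1 in
    Σ (Matrix n) λ N →
      IsWeighing n r N × Equivalent n W N ×
      (0 < n → n ≡ (r C 2) ℕ.+ 1 ℕ.+ k) ×
      (∀ (a c : Fin n) → toℕ a < r → N a c ≡ T r k (toℕ a) (toℕ c))
lemma3p3 zero    r W weighing meets =
  W , weighing , (W , W , empty , empty , λ ()) , (λ ()) , λ ()
  where
  empty : IsSignedPerm 0 W
  empty = (λ ()) , (λ ()) , (λ ())
lemma3p3 (suc m) r W weighing meets =
  normalised ,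
  signedRearrangement-isWeighing W σ τ s t s± t± weighing ,
  signedRearrangement-equivalent W σ τ s t s± t± ,
  (λ _ → size) ,
  λ a c a<r → trans (normalised-first-rows a c a<r) (sym (T≡columnEntry (suc m ∸ r C 2 ∸ 1) (toℕ a) (toℕ c) a<r))
  where
  open ThroughColumn W weighing meets Fin.zero
  size : suc m ≡ r C 2 ℕ.+ 1 ℕ.+ (suc m ∸ r C 2 ∸ 1)
  size = sym (trans (cong (r C 2 ℕ.+ 1 ℕ.+_) (ℕP.∸-+-assoc (suc m) (r C 2) 1)) (ℕP.m+[n∸m]≡n L≤n))
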